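{- Let $r\ge 2$ and $n\ge 0$. With $U_{n,\ell}^{(r)}$ the total number of $\mathbf{u}$-steps at level $\ell+1$ over all paths in $\mathcal{A}_{n+1,0}^{(r)}$ and $S_n^{(r)}=|\mathcal{A}_{n,0}^{(r)}|$, $$\sum_{\ell=0}^{n}(-1)^{\ell}U_{n,\ell}^{(r)}S_{\ell}^{(r)}=\sum_{\ell=0}^{n}(-1)^{n-\ell}S_{\ell+1}^{(r)}S_{n-\ell}(-1,(r-1)^2).$$ In particular, for $r=2$, $\sum_{\ell=0}^{n}(-1)^{\ell}U_{n,\ell}^{(2)}S_{\ell}=S_{n+1}$, where $S_n$ is the $n$th large Schröder number.
   Context: A Dyck path of length $2n$ is a lattice path from $(0,0)$ to $(2n,0)$ weakly above the $x$-axis with steps $\mathbf{u}=(1,1)$, $\mathbf{d}=(1,-1)$; an $r$-colored Dyck path has each $\mathbf{d}$-step colored with one of $r$ colors. $\mathcal{A}_{n,0}^{(r)}$ is the set of $r$-colored Dyck paths of length $2n$ with no two consecutive $\mathbf{d}$-steps of the same color. A step is at level $\ell$ if the ordinate of its endpoint is $\ell$. For parameters $a,b$, $S_n(a,b)=\sum_{k=0}^{n}\binom{n+k}{2k}C_k a^{n-k}b^k$ with $C_k=\frac{1}{k+1}\binom{2k}{k}$; the large Schröder number is $S_n=S_n(1,1)$, and $S_n^{(r)}=S_n(1,r-1)$. -}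

module Defs where

open import Data.Nat as ℕ using (ℕ; zero; suc; _∸_; _≡ᵇ_)
open import Data.Nat.Combinatorics using (_C_)
open import Data.Nat.DivMod using (_/_)
open import Data.Integer as ℤ using (ℤ; +_; -_)
open import Data.Fin using (Fin)
open import Data.Fin.Properties using () renaming (_≟_ to _≟ᶠ_)
open import Data.Bool using (Bool; true; false; _∧_; not; if_then_else_)
open import Data.List using (List; []; _∷_; map; concatMap; filterᵇ; length; upTo; allFin)
open import Relation.Nullary.Decidable using (⌊_⌋)

data Step (r : ℕ) : Set where
  u : Step r
  d : Fin r → Step r

allSteps : (r : ℕ) → List (Step r)
allSteps r = u ∷ map d (allFin r)

words : (r m : ℕ) → List (List (Step r))
words r zero = [] ∷ []
words r (suc m) = concatMap (λ w → map (_∷ w) (allSteps r)) (words r m)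

dyckFrom : {r : ℕ} → ℕ → List (Step r) → Bool
dyckFrom zero [] = true
dyckFrom (suc h) [] = false
dyckFrom h (u ∷ w) = dyckFrom (suc h) w
dyckFrom zero (d c ∷ w) = false
dyckFrom (suc h) (d c ∷ w) = dyckFrom h w

isDyck : {r : ℕ} → List (Step r) → Bool
isDyck = dyckFrom 0

noSameDD : {r : ℕ} → List (Step r) → Bool
noSameDD [] = true
noSameDD (u ∷ w) = noSameDD w
noSameDD (d c ∷ []) = true
noSameDD (d c ∷ u ∷ w) = noSameDD (u ∷ w)
noSameDD (d c ∷ d c' ∷ w) = not ⌊ c ≟ᶠ c' ⌋ ∧ noSameDD (d c' ∷ w)

𝒜 : (r n : ℕ) → List (List (Step r))
𝒜 r n = filterᵇ (λ w → isDyck w ∧ noSameDD w) (words r (2 ℕ.* n))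

Sᶜ : (r n : ℕ) → ℕ
Sᶜ r n = length (𝒜 r n)

upsAtFrom : {r : ℕ} → ℕ → ℕ → List (Step r) → ℕ
upsAtFrom L h [] = 0
upsAtFrom L h (u ∷ w) = (if suc h ≡ᵇ L then 1 else 0) ℕ.+ upsAtFrom L (suc h) w
upsAtFrom L h (d c ∷ w) = upsAtFrom L (h ∸ 1) w

U : (r n ℓ : ℕ) → ℕ
U r n ℓ = sumℕ (map (upsAtFrom (suc ℓ) 0) (𝒜 r (suc n)))
  where
  sumℕ : List ℕ → ℕ
  sumℕ [] = 0
  sumℕ (x ∷ xs) = x ℕ.+ sumℕ xs

sumTo : ℕ → (ℕ → ℤ) → ℤ
sumTo n f = go (upTo (suc n))
  where
  go : List ℕ → ℤ
  go [] = + 0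
  go (x ∷ xs) = f x ℤ.+ go xs

Catalan : ℕ → ℕ
Catalan k = ((2 ℕ.* k) C k) / suc k

Sab : ℕ → ℤ → ℤ → ℤ
Sab n a b = sumTo n (λ k → + (((n ℕ.+ k) C (2 ℕ.* k)) ℕ.* Catalan k) ℤ.* (a ℤ.^ (n ∸ k)) ℤ.* (b ℤ.^ k))

Schröder : ℕ → ℤ
Schröder n = Sab n (+ 1) (+ 1)

sgn : ℕ → ℤ
sgn m = (- (+ 1)) ℤ.^ m

-- Let A = ∑ S^(r)_n x^n, which satisfies A = 1 + x A + (r − 1) x A². Read a coloured path with an automaton
-- whose state is the current height and the colour of the last d-step: the accepted words from any state have
-- generating functions that are monomials in r − 1, A and A′ = (A − 1)/x. Cutting a path at an up step ending
-- at level ℓ + 1 gives U_{n,ℓ} = [x^(n−ℓ)] (r − 1)^ℓ A^(2ℓ+1) A′. Hence ∑ (−1)^ℓ U_{n,ℓ} S_ℓ = [x^n] A′ · P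
-- with P = A · A(Y) and Y = −(r − 1) x A², and P satisfies P = 1 + x P − (r − 1)² x P², whose only solution
-- is ∑ (−1)^m S_m(−1, (r − 1)²) x^m. For r = 2 that solution is 1, leaving [x^n] A′ = S_{n+1}.

module Submission where

open import Data.Nat as ℕ using (ℕ; zero; suc; z≤n; s≤s; _≤_; _<_; _∸_; _≡ᵇ_)
import Data.Nat.Properties as ℕP
import Data.Nat.Tactic.RingSolver as ℕ-Solver
open import Data.Nat.Combinatorics using (_C_; nCk+nC[k+1]≡[n+1]C[k+1]; k>n⇒nCk≡0; nCn≡1; nC1≡n; nCk≡nC[n∸k])
open import Data.Nat.DivMod using (m*n/n≡m)
open import Data.Nat.ListAction using (sum)
open import Data.Integer as ℤ using (ℤ; +_; -_; _+_; _*_; 0ℤ; 1ℤ; _^_)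
import Data.Integer.Properties as ℤP
open import Data.Integer.Tactic.RingSolver using (solve-∀)
open import Data.Maybe using (Maybe; just; nothing; maybe′; _>>=_)
open import Data.Bool using (Bool; true; false; _∧_; if_then_else_; T)
open import Data.Unit using (tt)
open import Data.Bool.Properties using (∧-zeroʳ)
open import Data.Fin as Fin using (Fin)
open import Data.Fin.Properties using () renaming (_≟_ to _≟ᶠ_)
open import Data.List using (List; []; _∷_; _++_; map; concatMap; concat; filterᵇ; length; foldr; applyUpTo; allFin)
open import Data.List.Properties using (foldr-universal; map-tabulate; length-tabulate)
open import Data.Product using (_×_; _,_; proj₁; proj₂)
open import Relation.Nullary using (yes; no)
open import Relation.Nullary.Decidable using (⌊_⌋)
open import Relation.Binary.PropositionalEquality
open import Relation.Binary.Bundles using (Setoid)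
open import Relation.Binary.Structures using (IsEquivalence)
open import Algebra.Bundles using (CommutativeRing)
open import Algebra.Solver.Ring.AlmostCommutativeRing
  using (fromCommutativeRing; _-Raw-AlmostCommutative⟶_)
import Algebra.Solver.Ring
import Algebra.Properties.CommutativeSemigroup as CommSemigroupProperties
open CommSemigroupProperties ℤP.+-commutativeSemigroup using ()
  renaming (interchange to +-interchange; x∙yz≈y∙xz to +-left-comm)
open CommSemigroupProperties ℤP.*-commutativeSemigroup using () renaming (x∙yz≈y∙xz to *-left-comm)
import Relation.Binary.Reasoning.Setoid
open import Defs

-- Formal power series over ℤ

Series : Set
Series = ℕ → ℤ

infix 4 _≈_
_≈_ : Series → Series → Set
f ≈ g = ∀ n → f n ≡ g n

infixl 6 _⊕_
infixl 7 _⊛_ _⊙_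

_⊕_ : Series → Series → Series
(f ⊕ g) n = f n + g n

⊝_ : Series → Series
(⊝ f) n = - f n

_⊙_ : ℤ → Series → Series
(k ⊙ f) n = k * f n

𝟘 : Series
𝟘 _ = 0ℤ

𝟙 : Series
𝟙 zero = 1ℤ
𝟙 (suc n) = 0ℤ

const : ℤ → Series
const k = k ⊙ 𝟙

tail : Series → Series
tail f n = f (suc n)

shift : Series → Series
shift f zero = 0ℤ
shift f (suc n) = f n

𝐱 : Series
𝐱 = shift 𝟙

_⊛_ : Series → Series → Series
(f ⊛ g) zero = f 0 * g 0
(f ⊛ g) (suc n) = f 0 * g (suc n) + (tail f ⊛ g) n

≈-refl : ∀ {f} → f ≈ f
≈-refl n = refl

≈-sym : ∀ {f g} → f ≈ g → g ≈ f
≈-sym p n = sym (p n)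

≈-trans : ∀ {f g h} → f ≈ g → g ≈ h → f ≈ h
≈-trans p q n = trans (p n) (q n)

≈-isEquivalence : IsEquivalence _≈_
≈-isEquivalence = record { refl = λ {f} → ≈-refl {f} ; sym = ≈-sym ; trans = ≈-trans }

≈-setoid : Setoid _ _
≈-setoid = record { isEquivalence = ≈-isEquivalence }

module ≈-Reasoning = Relation.Binary.Reasoning.Setoid ≈-setoid

⊕-cong : ∀ {f f′ g g′} → f ≈ f′ → g ≈ g′ → f ⊕ g ≈ f′ ⊕ g′
⊕-cong p q n = cong₂ _+_ (p n) (q n)

⊝-cong : ∀ {f f′} → f ≈ f′ → ⊝ f ≈ ⊝ f′
⊝-cong p n = cong -_ (p n)

⊙-cong : ∀ k {f g} → f ≈ g → k ⊙ f ≈ k ⊙ g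
⊙-cong k p n = cong (k *_) (p n)

tail-cong : ∀ {f g} → f ≈ g → tail f ≈ tail g
tail-cong p n = p (suc n)

shift-cong : ∀ {f g} → f ≈ g → shift f ≈ shift g
shift-cong p zero = refl
shift-cong p (suc n) = p n

⊛-cong : ∀ {f f′ g g′} → f ≈ f′ → g ≈ g′ → f ⊛ g ≈ f′ ⊛ g′
⊛-cong p q zero = cong₂ _*_ (p 0) (q 0)
⊛-cong p q (suc n) = cong₂ _+_ (cong₂ _*_ (p 0) (q (suc n))) (⊛-cong (tail-cong p) q n)

⊛-zeroˡ : ∀ f → 𝟘 ⊛ f ≈ 𝟘
⊛-zeroˡ f zero = ℤP.*-zeroˡ (f 0)
⊛-zeroˡ f (suc n) = cong₂ _+_ (ℤP.*-zeroˡ (f (suc n))) (⊛-zeroˡ f n)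

⊛-identityˡ : ∀ f → 𝟙 ⊛ f ≈ f
⊛-identityˡ f zero = ℤP.*-identityˡ (f 0)
⊛-identityˡ f (suc n) =
  trans (cong₂ _+_ (ℤP.*-identityˡ (f (suc n))) (⊛-zeroˡ f n)) (ℤP.+-identityʳ _)

⊛-distribʳ-⊕ : ∀ h f g → (f ⊕ g) ⊛ h ≈ f ⊛ h ⊕ g ⊛ h
⊛-distribʳ-⊕ h f g zero = ℤP.*-distribʳ-+ (h 0) (f 0) (g 0)
⊛-distribʳ-⊕ h f g (suc n) =
  trans (cong₂ _+_ (ℤP.*-distribʳ-+ (h (suc n)) (f 0) (g 0)) (⊛-distribʳ-⊕ h (tail f) (tail g) n))
        (+-interchange (f 0 * h (suc n)) (g 0 * h (suc n)) ((tail f ⊛ h) n) ((tail g ⊛ h) n))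

⊛-distribˡ-⊕ : ∀ h f g → h ⊛ (f ⊕ g) ≈ h ⊛ f ⊕ h ⊛ g
⊛-distribˡ-⊕ h f g zero = ℤP.*-distribˡ-+ (h 0) (f 0) (g 0)
⊛-distribˡ-⊕ h f g (suc n) =
  trans (cong₂ _+_ (ℤP.*-distribˡ-+ (h 0) (f (suc n)) (g (suc n))) (⊛-distribˡ-⊕ (tail h) f g n))
        (+-interchange (h 0 * f (suc n)) (h 0 * g (suc n)) ((tail h ⊛ f) n) ((tail h ⊛ g) n))

⊙-⊛ˡ : ∀ k f g → (k ⊙ f) ⊛ g ≈ k ⊙ (f ⊛ g)
⊙-⊛ˡ k f g zero = ℤP.*-assoc k (f 0) (g 0)
⊙-⊛ˡ k f g (suc n) =
  trans (cong₂ _+_ (ℤP.*-assoc k (f 0) (g (suc n))) (⊙-⊛ˡ k (tail f) g n))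
        (sym (ℤP.*-distribˡ-+ k _ _))

⊙-⊛ʳ : ∀ k f g → f ⊛ (k ⊙ g) ≈ k ⊙ (f ⊛ g)
⊙-⊛ʳ k f g zero = *-left-comm (f 0) k (g 0)
⊙-⊛ʳ k f g (suc n) =
  trans (cong₂ _+_ (*-left-comm (f 0) k (g (suc n))) (⊙-⊛ʳ k (tail f) g n))
        (sym (ℤP.*-distribˡ-+ k _ _))

⊛-assoc : ∀ f g h → (f ⊛ g) ⊛ h ≈ f ⊛ (g ⊛ h)
⊛-assoc f g h zero = ℤP.*-assoc (f 0) (g 0) (h 0)
⊛-assoc f g h (suc n) = begin
    f 0 * g 0 * h (suc n) + ((f 0 ⊙ tail g ⊕ tail f ⊛ g) ⊛ h) n
  ≡⟨ cong (_+_ (f 0 * g 0 * h (suc n))) (⊛-distribʳ-⊕ h (f 0 ⊙ tail g) (tail f ⊛ g) n) ⟩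
    f 0 * g 0 * h (suc n) + (((f 0 ⊙ tail g) ⊛ h) n + ((tail f ⊛ g) ⊛ h) n)
  ≡⟨ cong₂ (λ a b → f 0 * g 0 * h (suc n) + (a + b)) (⊙-⊛ˡ (f 0) (tail g) h n) (⊛-assoc (tail f) g h n) ⟩
    f 0 * g 0 * h (suc n) + (f 0 * (tail g ⊛ h) n + (tail f ⊛ (g ⊛ h)) n)
  ≡⟨ regroup (f 0) (g 0) (h (suc n)) _ _ ⟩
    f 0 * (g 0 * h (suc n) + (tail g ⊛ h) n) + (tail f ⊛ (g ⊛ h)) n ∎
  where
  open ≡-Reasoning
  regroup : ∀ a b c d e → a * b * c + (a * d + e) ≡ a * (b * c + d) + e
  regroup = solve-∀

⊛-comm : ∀ f g → f ⊛ g ≈ g ⊛ f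
⊛-comm f g zero = ℤP.*-comm (f 0) (g 0)
⊛-comm f g (suc zero) = swap (f 0) (g 1) (f 1) (g 0)
  where
  swap : ∀ a b c d → a * b + c * d ≡ d * c + b * a
  swap = solve-∀
⊛-comm f g (suc (suc m)) = begin
    f 0 * g (2 ℕ.+ m) + (tail f ⊛ g) (suc m)
  ≡⟨ cong (_+_ (f 0 * g (2 ℕ.+ m))) (⊛-comm (tail f) g (suc m)) ⟩
    f 0 * g (2 ℕ.+ m) + (g 0 * f (2 ℕ.+ m) + (tail g ⊛ tail f) m)
  ≡⟨ cong (λ z → f 0 * g (2 ℕ.+ m) + (g 0 * f (2 ℕ.+ m) + z)) (⊛-comm (tail g) (tail f) m) ⟩
    f 0 * g (2 ℕ.+ m) + (g 0 * f (2 ℕ.+ m) + (tail f ⊛ tail g) m)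
  ≡⟨ +-left-comm (f 0 * g (2 ℕ.+ m)) (g 0 * f (2 ℕ.+ m)) _ ⟩
    g 0 * f (2 ℕ.+ m) + (f 0 * g (2 ℕ.+ m) + (tail f ⊛ tail g) m)
  ≡⟨ cong (_+_ (g 0 * f (2 ℕ.+ m))) (⊛-comm f (tail g) (suc m)) ⟩
    g 0 * f (2 ℕ.+ m) + (tail g ⊛ f) (suc m) ∎
  where open ≡-Reasoning

⊛-identityʳ : ∀ f → f ⊛ 𝟙 ≈ f
⊛-identityʳ f = ≈-trans (⊛-comm f 𝟙) (⊛-identityˡ f)

⊛-zeroʳ : ∀ f → f ⊛ 𝟘 ≈ 𝟘
⊛-zeroʳ f = ≈-trans (⊛-comm f 𝟘) (⊛-zeroˡ f)

SeriesRing : CommutativeRing _ _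
SeriesRing = record
  { Carrier = Series
  ; _≈_ = _≈_
  ; _+_ = _⊕_
  ; _*_ = _⊛_
  ; -_ = ⊝_
  ; 0# = 𝟘
  ; 1# = 𝟙
  ; isCommutativeRing = record
    { isRing = record
      { +-isAbelianGroup = record
        { isGroup = record
          { isMonoid = record
            { isSemigroup = record
              { isMagma = record { isEquivalence = ≈-isEquivalence ; ∙-cong = ⊕-cong }
              ; assoc = λ f g h n → ℤP.+-assoc (f n) (g n) (h n) }
            ; identity = (λ f n → ℤP.+-identityˡ (f n)) , (λ f n → ℤP.+-identityʳ (f n)) }
          ; inverse = (λ f n → ℤP.+-inverseˡ (f n)) , (λ f n → ℤP.+-inverseʳ (f n))
          ; ⁻¹-cong = ⊝-cong }
        ; comm = λ f g n → ℤP.+-comm (f n) (g n) }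
      ; *-cong = ⊛-cong
      ; *-assoc = ⊛-assoc
      ; *-identity = ⊛-identityˡ , ⊛-identityʳ
      ; distrib = ⊛-distribˡ-⊕ , ⊛-distribʳ-⊕ }
    ; *-comm = ⊛-comm } }

const-⊛ : ∀ a f → const a ⊛ f ≈ a ⊙ f
const-⊛ a f n = trans (⊙-⊛ˡ a 𝟙 f n) (cong (a *_) (⊛-identityˡ f n))

const-* : ∀ a b → const (a * b) ≈ const a ⊛ const b
const-* a b n = trans (ℤP.*-assoc a b (𝟙 n)) (sym (const-⊛ a (const b) n))

const-1 : const 1ℤ ≈ 𝟙
const-1 n = ℤP.*-identityˡ (𝟙 n)

module SeriesSolver where
  const-morphism : ℤ.+-*-rawRing -Raw-AlmostCommutative⟶ fromCommutativeRing SeriesRing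
  const-morphism = record
    { ⟦_⟧ = const
    ; +-homo = λ a b n → ℤP.*-distribʳ-+ (𝟙 n) a b
    ; *-homo = const-*
    ; -‿homo = λ a n → sym (ℤP.neg-distribˡ-* a (𝟙 n))
    ; 0-homo = λ n → ℤP.*-zeroˡ (𝟙 n)
    ; 1-homo = const-1 }

  const-≟ : ∀ a b → Maybe (const a ≈ const b)
  const-≟ a b with a ℤ.≟ b
  ... | yes refl = just ≈-refl
  ... | no _ = nothing

  open Algebra.Solver.Ring ℤ.+-*-rawRing (fromCommutativeRing SeriesRing) const-morphism const-≟ public

-- The premise is shaped so that it is a ring identity, left to the solver.
≈-using-relations : ∀ {X Y m₁ m₂ A₁ B₁ A₂ B₂} →
  X ≈ Y ⊕ m₁ ⊛ (A₁ ⊕ ⊝ B₁) ⊕ m₂ ⊛ (A₂ ⊕ ⊝ B₂) → A₁ ≈ B₁ → A₂ ≈ B₂ → X ≈ Y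
≈-using-relations {Y = Y} {m₁} {m₂} e p q n =
  trans (e n) (trans (cong₂ (λ s t → Y n + s + t) (vanish m₁ p n) (vanish m₂ q n))
                     (trans (ℤP.+-identityʳ _) (ℤP.+-identityʳ _)))
  where
  vanish : ∀ m {A B} → A ≈ B → m ⊛ (A ⊕ ⊝ B) ≈ 𝟘
  vanish m {A} p =
    ≈-trans (⊛-cong (≈-refl {m}) (λ i → trans (cong (λ b → A i + - b) (sym (p i))) (ℤP.+-inverseʳ (A i))))
                           (⊛-zeroʳ m)

shift≈𝐱⊛ : ∀ f → shift f ≈ 𝐱 ⊛ f
shift≈𝐱⊛ f zero = sym (ℤP.*-zeroˡ (f 0))
shift≈𝐱⊛ f (suc n) =
  sym (trans (cong₂ _+_ (ℤP.*-zeroˡ (f (suc n))) (⊛-identityˡ f n)) (ℤP.+-identityˡ (f n)))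

shift-⊛ : ∀ f g → shift f ⊛ g ≈ shift (f ⊛ g)
shift-⊛ f g zero = ℤP.*-zeroˡ (g 0)
shift-⊛ f g (suc n) =
  trans (cong (_+ (f ⊛ g) n) (ℤP.*-zeroˡ (g (suc n)))) (ℤP.+-identityˡ ((f ⊛ g) n))

tail-𝐱⊛ : ∀ f → tail (𝐱 ⊛ f) ≈ f
tail-𝐱⊛ f n = sym (shift≈𝐱⊛ f (suc n))

const+shift-tail : ∀ f → f ≈ const (f 0) ⊕ shift (tail f)
const+shift-tail f zero = sym (trans (cong (_+ 0ℤ) (ℤP.*-identityʳ (f 0))) (ℤP.+-identityʳ (f 0)))
const+shift-tail f (suc n) = sym (trans (cong (_+ f (suc n)) (ℤP.*-zeroʳ (f 0))) (ℤP.+-identityˡ (f (suc n))))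

∑ : ℕ → (ℕ → ℤ) → ℤ
∑ zero f = 0ℤ
∑ (suc N) f = f 0 + ∑ N (λ ℓ → f (suc ℓ))

∑-cong : ∀ N {f g} → (∀ ℓ → ℓ < N → f ℓ ≡ g ℓ) → ∑ N f ≡ ∑ N g
∑-cong zero p = refl
∑-cong (suc N) p = cong₂ _+_ (p 0 (s≤s z≤n)) (∑-cong N (λ ℓ ℓ<N → p (suc ℓ) (s≤s ℓ<N)))

∑-zero : ∀ N {f} → (∀ ℓ → f ℓ ≡ 0ℤ) → ∑ N f ≡ 0ℤ
∑-zero zero p = refl
∑-zero (suc N) p = cong₂ _+_ (p 0) (∑-zero N (λ ℓ → p (suc ℓ)))

∑-+ : ∀ N f g → ∑ N (λ ℓ → f ℓ + g ℓ) ≡ ∑ N f + ∑ N g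
∑-+ zero f g = refl
∑-+ (suc N) f g =
  trans (cong (_+_ (f 0 + g 0)) (∑-+ N (λ ℓ → f (suc ℓ)) (λ ℓ → g (suc ℓ))))
        (+-interchange (f 0) (g 0) _ _)

∑-*ˡ : ∀ N k f → ∑ N (λ ℓ → k * f ℓ) ≡ k * ∑ N f
∑-*ˡ zero k f = sym (ℤP.*-zeroʳ k)
∑-*ˡ (suc N) k f =
  trans (cong (_+_ (k * f 0)) (∑-*ˡ N k (λ ℓ → f (suc ℓ)))) (sym (ℤP.*-distribˡ-+ k _ _))

∑-vanishing-tail : ∀ M j f → (∀ ℓ → M ≤ ℓ → f ℓ ≡ 0ℤ) → ∑ (M ℕ.+ j) f ≡ ∑ M f
∑-vanishing-tail zero j f p = ∑-zero j (λ ℓ → p ℓ z≤n)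
∑-vanishing-tail (suc M) j f p =
  cong (_+_ (f 0)) (∑-vanishing-tail M j (λ ℓ → f (suc ℓ)) (λ ℓ M≤ℓ → p (suc ℓ) (s≤s M≤ℓ)))

sumTo-foldr : ∀ n f → sumTo n f ≡ f 0 + foldr (λ x s → f x + s) 0ℤ (applyUpTo suc n)
sumTo-foldr n f with foldr-universal _ (λ x s → f x + s) 0ℤ refl (λ _ _ → refl) | applyUpTo suc n
... | go≗foldr | xs = cong (_+_ (f 0)) (go≗foldr xs)

foldr-applyUpTo : ∀ (f : ℕ → ℤ) g N → foldr (λ x s → f x + s) 0ℤ (applyUpTo g N) ≡ ∑ N (λ ℓ → f (g ℓ))
foldr-applyUpTo f g zero = refl
foldr-applyUpTo f g (suc N) = cong (_+_ (f (g 0))) (foldr-applyUpTo f (λ ℓ → g (suc ℓ)) N)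

sumTo≡∑ : ∀ n f → sumTo n f ≡ ∑ (suc n) f
sumTo≡∑ n f = trans (sumTo-foldr n f) (cong (_+_ (f 0)) (foldr-applyUpTo f suc n))

⊛-as-∑ : ∀ f g n → (f ⊛ g) n ≡ ∑ (suc n) (λ ℓ → f ℓ * g (n ∸ ℓ))
⊛-as-∑ f g zero = sym (ℤP.+-identityʳ _)
⊛-as-∑ f g (suc n) = cong (_+_ (f 0 * g (suc n))) (⊛-as-∑ (tail f) g n)

∑ˢ : ℕ → (ℕ → Series) → Series
∑ˢ N s n = ∑ N (λ ℓ → s ℓ n)

∑ˢ-cong : ∀ N {s t} → (∀ ℓ → s ℓ ≈ t ℓ) → ∑ˢ N s ≈ ∑ˢ N t
∑ˢ-cong N p n = ∑-cong N (λ ℓ _ → p ℓ n)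

⊛-∑ˢ : ∀ N h s → h ⊛ ∑ˢ N s ≈ ∑ˢ N (λ ℓ → h ⊛ s ℓ)
⊛-∑ˢ zero h s = ⊛-zeroʳ h
⊛-∑ˢ (suc N) h s =
  ≈-trans (⊛-distribˡ-⊕ h (s 0) (∑ˢ N (λ ℓ → s (suc ℓ))))
          (⊕-cong (≈-refl {h ⊛ s 0}) (⊛-∑ˢ N h (λ ℓ → s (suc ℓ))))

infix 4 _≈[_]_
_≈[_]_ : Series → ℕ → Series → Set
f ≈[ n ] g = ∀ i → i ≤ n → f i ≡ g i

≈[]-weaken : ∀ {f g m n} → m ≤ n → f ≈[ n ] g → f ≈[ m ] g
≈[]-weaken m≤n p i i≤m = p i (ℕP.≤-trans i≤m m≤n)

⊛-cong-at : ∀ n {f f′ g g′} → f ≈[ n ] f′ → g ≈[ n ] g′ → (f ⊛ g) n ≡ (f′ ⊛ g′) n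
⊛-cong-at zero p q = cong₂ _*_ (p 0 z≤n) (q 0 z≤n)
⊛-cong-at (suc n) p q = cong₂ _+_ (cong₂ _*_ (p 0 z≤n) (q (suc n) ℕP.≤-refl))
  (⊛-cong-at n (λ i i≤n → p (suc i) (s≤s i≤n)) (≈[]-weaken (ℕP.n≤1+n n) q))

⊛-cong-≈[] : ∀ n {f f′ g g′} → f ≈[ n ] f′ → g ≈[ n ] g′ → f ⊛ g ≈[ n ] f′ ⊛ g′
⊛-cong-≈[] n p q i i≤n = ⊛-cong-at i (≈[]-weaken i≤n p) (≈[]-weaken i≤n q)

⊕-cong-≈[] : ∀ n {f f′ g g′} → f ≈[ n ] f′ → g ≈[ n ] g′ → f ⊕ g ≈[ n ] f′ ⊕ g′
⊕-cong-≈[] n p q i i≤n = cong₂ _+_ (p i i≤n) (q i i≤n)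

shift-cong-≈[] : ∀ n {f g} → f ≈[ n ] g → shift f ≈[ suc n ] shift g
shift-cong-≈[] n p zero _ = refl
shift-cong-≈[] n p (suc i) (s≤s i≤n) = p i i≤n

Causal : (Series → Series) → Set
Causal H = ∀ n {X Y} → X ≈[ n ] Y → H X ≈[ n ] H Y

module FixedPoint (c₀ : Series) (H : Series → Series) (H-causal : Causal H) where

  unique : ∀ {X Y} → X ≈ c₀ ⊕ shift (H X) → Y ≈ c₀ ⊕ shift (H Y) → X ≈ Y
  unique {X} {Y} hX hY n = agree n n ℕP.≤-refl
    where
    agree : ∀ n i → i ≤ n → X i ≡ Y i
    agree n zero _ = trans (hX 0) (sym (hY 0))
    agree (suc n) (suc i) (s≤s i≤n) =
      trans (hX (suc i)) (trans (cong (_+_ (c₀ (suc i))) (H-causal n (agree n) i i≤n)) (sym (hY (suc i))))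

  private
    Ψ : Series → Series
    Ψ X = c₀ ⊕ shift (H X)

    Ψ-contracts : ∀ n {X Y} → X ≈[ n ] Y → Ψ X ≈[ suc n ] Ψ Y
    Ψ-contracts n p = ⊕-cong-≈[] (suc n) {c₀} {c₀} (λ _ _ → refl) (shift-cong-≈[] n (H-causal n p))

    iterate : ℕ → Series
    iterate zero = 𝟘
    iterate (suc k) = Ψ (iterate k)

    iterate-stable : ∀ k → iterate (suc k) ≈[ k ] iterate (suc (suc k))
    iterate-stable zero zero z≤n = refl
    iterate-stable (suc k) = Ψ-contracts k (iterate-stable k)

    iterate-stable+ : ∀ k j → iterate (suc k) ≈[ k ] iterate (suc (j ℕ.+ k))
    iterate-stable+ k zero i _ = refl
    iterate-stable+ k (suc j) i i≤k =
      trans (iterate-stable+ k j i i≤k) (iterate-stable (j ℕ.+ k) i (ℕP.≤-trans i≤k (ℕP.m≤n+m k j)))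

  -- The k-th iterate of Ψ from 𝟘 is already correct in degrees below k.
  fix : Series
  fix n = iterate (suc n) n

  private
    fix≈[]iterate : ∀ k → fix ≈[ k ] iterate (suc k)
    fix≈[]iterate k i i≤k with ℕP.m≤n⇒∃[o]m+o≡n i≤k
    ... | j , i+j≡k =
      trans (iterate-stable+ i j i ℕP.≤-refl) (cong (λ m → iterate (suc m) i) (trans (ℕP.+-comm j i) i+j≡k))

  fix-eq : fix ≈ c₀ ⊕ shift (H fix)
  fix-eq zero = refl
  fix-eq (suc n) =
    Ψ-contracts n (λ i i≤n → sym (fix≈[]iterate n i i≤n)) (suc n) ℕP.≤-refl

⊛-cancel-unit : ∀ A E → A 0 ≡ 1ℤ → A ⊛ E ≈ 𝟘 → E ≈ 𝟘
⊛-cancel-unit A E A0≡1 AE≈0 n = vanish n n ℕP.≤-refl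
  where
  vanish : ∀ n i → i ≤ n → E i ≡ 0ℤ
  vanish n zero _ = trans (sym (ℤP.*-identityˡ (E 0))) (trans (cong (_* E 0) (sym A0≡1)) (AE≈0 0))
  vanish (suc n) (suc i) (s≤s i≤n) = begin
      E (suc i)
    ≡⟨ sym (trans (cong₂ (λ a b → a * E (suc i) + b) A0≡1 tail-part)
                  (trans (ℤP.+-identityʳ _) (ℤP.*-identityˡ _))) ⟩
      (A ⊛ E) (suc i)
    ≡⟨ AE≈0 (suc i) ⟩
      0ℤ ∎
    where
    open ≡-Reasoning
    tail-part : (tail A ⊛ E) i ≡ 0ℤ
    tail-part = trans (⊛-cong-at i {tail A} {tail A} (λ _ _ → refl) (λ j j≤i → vanish n j (ℕP.≤-trans j≤i i≤n)))
                      (⊛-zeroʳ (tail A) i)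

infixr 8 _^ˢ_
_^ˢ_ : Series → ℕ → Series
F ^ˢ zero = 𝟙
F ^ˢ suc k = F ⊛ F ^ˢ k

^ˢ-distrib-⊛ : ∀ f g ℓ → (f ⊛ g) ^ˢ ℓ ≈ f ^ˢ ℓ ⊛ g ^ˢ ℓ
^ˢ-distrib-⊛ f g zero = ≈-sym (⊛-identityˡ 𝟙)
^ˢ-distrib-⊛ f g (suc ℓ) =
  ≈-trans (⊛-cong (≈-refl {f ⊛ g}) (^ˢ-distrib-⊛ f g ℓ)) (interchange-⊛ f g (f ^ˢ ℓ) (g ^ˢ ℓ))
  where
  open SeriesSolver
  interchange-⊛ : ∀ f g pf pg → (f ⊛ g) ⊛ (pf ⊛ pg) ≈ (f ⊛ pf) ⊛ (g ⊛ pg)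
  interchange-⊛ = solve 4 (λ f g pf pg → (f :* g) :* (pf :* pg) := (f :* pf) :* (g :* pg)) ≈-refl

const-^ˢ : ∀ c ℓ → const c ^ˢ ℓ ≈ const (c ^ ℓ)
const-^ˢ c zero = ≈-sym const-1
const-^ˢ c (suc ℓ) = ≈-trans (⊛-cong (≈-refl {const c}) (const-^ˢ c ℓ)) (≈-sym (const-* c (c ^ ℓ)))

-- compose c is c(F) = ∑ c ℓ F^ℓ, which is well defined because F^ℓ starts in degree ℓ.
module Composition (F : Series) (F0≡0 : F 0 ≡ 0ℤ) where

  ⊛-via-shift : ∀ X → F ⊛ X ≈ shift (tail F ⊛ X)
  ⊛-via-shift X = ≈-trans (⊛-cong F≈shift-tail ≈-refl) (shift-⊛ (tail F) X)
    where
    F≈shift-tail : F ≈ shift (tail F)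
    F≈shift-tail zero = F0≡0
    F≈shift-tail (suc n) = refl

  ⊛-cong-≈[]-suc : ∀ m {X Y} → X ≈[ m ] Y → F ⊛ X ≈[ suc m ] F ⊛ Y
  ⊛-cong-≈[]-suc m {X} {Y} p i i≤ =
    trans (⊛-via-shift X i)
          (trans (shift-cong-≈[] m (⊛-cong-≈[] m {tail F} {tail F} (λ _ _ → refl) p) i i≤)
                 (sym (⊛-via-shift Y i)))

  ⊛-at-0 : ∀ X Y → (F ⊛ X) 0 ≡ (F ⊛ Y) 0
  ⊛-at-0 X Y = trans (⊛-via-shift X 0) (sym (⊛-via-shift Y 0))

  ^ˢ-vanish : ∀ k i → i < k → (F ^ˢ k) i ≡ 0ℤ
  ^ˢ-vanish (suc k) zero _ = ⊛-via-shift (F ^ˢ k) 0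
  ^ˢ-vanish (suc k) (suc i) (s≤s i<k) =
    trans (⊛-via-shift (F ^ˢ k) (suc i))
          (trans (⊛-cong-at i {tail F} {tail F} {F ^ˢ k} {𝟘} (λ _ _ → refl)
                   (λ j j≤i → ^ˢ-vanish k j (ℕP.<-≤-trans (s≤s j≤i) i<k)))
                 (⊛-zeroʳ (tail F) i))

  partialSum : Series → ℕ → Series
  partialSum c N = ∑ˢ N (λ ℓ → c ℓ ⊙ F ^ˢ ℓ)

  compose : Series → Series
  compose c n = partialSum c (suc n) n

  compose≈[]partialSum : ∀ c {n N} → n < N → compose c ≈[ n ] partialSum c N
  compose≈[]partialSum c {n} {N} n<N i i≤n with ℕP.m≤n⇒∃[o]m+o≡n (ℕP.<-≤-trans (s≤s i≤n) n<N)
  ... | j , refl = sym (∑-vanishing-tail (suc i) j (λ ℓ → c ℓ * (F ^ˢ ℓ) i)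
                         (λ ℓ i<ℓ → trans (cong (c ℓ *_) (^ˢ-vanish ℓ i i<ℓ)) (ℤP.*-zeroʳ (c ℓ))))

  partialSum-horner : ∀ c N → partialSum c (suc N) ≈ const (c 0) ⊕ F ⊛ partialSum (tail c) N
  partialSum-horner c N =
    ⊕-cong (≈-refl {const (c 0)})
           (≈-sym (≈-trans (⊛-∑ˢ N F (λ ℓ → c (suc ℓ) ⊙ F ^ˢ ℓ))
                           (∑ˢ-cong N (λ ℓ → ⊙-⊛ʳ (c (suc ℓ)) F (F ^ˢ ℓ)))))

  compose-horner : ∀ c → compose c ≈ const (c 0) ⊕ F ⊛ compose (tail c)
  compose-horner c zero =
    trans (partialSum-horner c 0 0) (cong (_+_ (const (c 0) 0)) (⊛-at-0 (partialSum (tail c) 0) (compose (tail c))))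
  compose-horner c (suc n) =
    trans (partialSum-horner c (suc n) (suc n))
          (cong (_+_ (const (c 0) (suc n)))
                (⊛-cong-≈[]-suc n (λ i i≤n → sym (compose≈[]partialSum (tail c) ℕP.≤-refl i i≤n))
                                (suc n) ℕP.≤-refl))

  compose-cong : ∀ {c e} → c ≈ e → compose c ≈ compose e
  compose-cong p n = ∑-cong (suc n) (λ ℓ _ → cong (_* (F ^ˢ ℓ) n) (p ℓ))

  compose-⊕ : ∀ c e → compose (c ⊕ e) ≈ compose c ⊕ compose e
  compose-⊕ c e n =
    trans (∑-cong (suc n) (λ ℓ _ → ℤP.*-distribʳ-+ ((F ^ˢ ℓ) n) (c ℓ) (e ℓ)))
          (∑-+ (suc n) (λ ℓ → c ℓ * (F ^ˢ ℓ) n) (λ ℓ → e ℓ * (F ^ˢ ℓ) n))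

  compose-⊙ : ∀ k c → compose (k ⊙ c) ≈ k ⊙ compose c
  compose-⊙ k c n =
    trans (∑-cong (suc n) (λ ℓ _ → ℤP.*-assoc k (c ℓ) ((F ^ˢ ℓ) n)))
          (∑-*ˡ (suc n) k (λ ℓ → c ℓ * (F ^ˢ ℓ) n))

  compose-const : ∀ a → compose (const a) ≈ const a
  compose-const a n =
    trans (cong (_+_ (const a 0 * 𝟙 n))
                (∑-zero n (λ ℓ → trans (cong (_* (F ^ˢ suc ℓ) n) (ℤP.*-zeroʳ a)) (ℤP.*-zeroˡ ((F ^ˢ suc ℓ) n)))))
          (trans (ℤP.+-identityʳ _) (cong (_* 𝟙 n) (ℤP.*-identityʳ a)))

  compose-shift : ∀ c → compose (shift c) ≈ F ⊛ compose c
  compose-shift c n =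
    trans (compose-horner (shift c) n) (trans (cong (_+ (F ⊛ compose c) n) (ℤP.*-zeroˡ (𝟙 n))) (ℤP.+-identityˡ _))

  compose-𝟙 : compose 𝟙 ≈ 𝟙
  compose-𝟙 = ≈-trans (compose-cong (≈-sym const-1)) (≈-trans (compose-const 1ℤ) const-1)

  compose-𝐱 : compose 𝐱 ≈ F
  compose-𝐱 = ≈-trans (compose-shift 𝟙) (≈-trans (⊛-cong (≈-refl {F}) compose-𝟙) (⊛-identityʳ F))

  private
    compose-⊛-horner : ∀ c e → compose (c ⊛ e)
      ≈ const (c 0) ⊛ const (e 0) ⊕ F ⊛ (const (c 0) ⊛ compose (tail e) ⊕ compose (tail c ⊛ e))
    compose-⊛-horner c e = begin
        compose (c ⊛ e)
      ≈⟨ compose-horner (c ⊛ e) ⟩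
        const (c 0 * e 0) ⊕ F ⊛ compose (c 0 ⊙ tail e ⊕ tail c ⊛ e)
      ≈⟨ ⊕-cong (const-* (c 0) (e 0)) (⊛-cong (≈-refl {F}) (compose-⊕ (c 0 ⊙ tail e) (tail c ⊛ e))) ⟩
        const (c 0) ⊛ const (e 0) ⊕ F ⊛ (compose (c 0 ⊙ tail e) ⊕ compose (tail c ⊛ e))
      ≈⟨ ⊕-cong (≈-refl {const (c 0) ⊛ const (e 0)})
                (⊛-cong (≈-refl {F}) (⊕-cong (≈-trans (compose-⊙ (c 0) (tail e))
                                                      (≈-sym (const-⊛ (c 0) (compose (tail e)))))
                                             (≈-refl {compose (tail c ⊛ e)}))) ⟩
        const (c 0) ⊛ const (e 0) ⊕ F ⊛ (const (c 0) ⊛ compose (tail e) ⊕ compose (tail c ⊛ e)) ∎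
      where open ≈-Reasoning

    ⊛-compose-horner : ∀ c e → compose c ⊛ compose e
      ≈ const (c 0) ⊛ const (e 0) ⊕ F ⊛ (const (c 0) ⊛ compose (tail e) ⊕ compose (tail c) ⊛ compose e)
    ⊛-compose-horner c e = begin
        compose c ⊛ compose e
      ≈⟨ ⊛-cong (compose-horner c) (compose-horner e) ⟩
        (const (c 0) ⊕ F ⊛ compose (tail c)) ⊛ (const (e 0) ⊕ F ⊛ compose (tail e))
      ≈⟨ expand (const (c 0)) (const (e 0)) F (compose (tail c)) (compose (tail e)) ⟩
        const (c 0) ⊛ const (e 0)
          ⊕ F ⊛ (const (c 0) ⊛ compose (tail e) ⊕ compose (tail c) ⊛ (const (e 0) ⊕ F ⊛ compose (tail e)))
      ≈⟨ ⊕-cong (≈-refl {const (c 0) ⊛ const (e 0)})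
                (⊛-cong (≈-refl {F}) (⊕-cong (≈-refl {const (c 0) ⊛ compose (tail e)})
                                             (⊛-cong (≈-refl {compose (tail c)}) (≈-sym (compose-horner e))))) ⟩
        const (c 0) ⊛ const (e 0) ⊕ F ⊛ (const (c 0) ⊛ compose (tail e) ⊕ compose (tail c) ⊛ compose e) ∎
      where
      open ≈-Reasoning
      open SeriesSolver
      expand : ∀ c₀ e₀ f c′ e′ →
        (c₀ ⊕ f ⊛ c′) ⊛ (e₀ ⊕ f ⊛ e′) ≈ c₀ ⊛ e₀ ⊕ f ⊛ (c₀ ⊛ e′ ⊕ c′ ⊛ (e₀ ⊕ f ⊛ e′))
      expand = solve 5 (λ c₀ e₀ f c′ e′ →
        (c₀ :+ f :* c′) :* (e₀ :+ f :* e′) := c₀ :* e₀ :+ f :* (c₀ :* e′ :+ c′ :* (e₀ :+ f :* e′))) ≈-refl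

  -- Both sides satisfy the same Horner recursion, whose F-part only sees lower degrees.
  compose-⊛ : ∀ c e → compose (c ⊛ e) ≈ compose c ⊛ compose e
  compose-⊛ c e n = agree n c n ℕP.≤-refl
    where
    agree : ∀ n c i → i ≤ n → compose (c ⊛ e) i ≡ (compose c ⊛ compose e) i
    agree n c zero _ =
      trans (compose-⊛-horner c e 0)
            (trans (cong (_+_ ((const (c 0) ⊛ const (e 0)) 0))
                         (⊛-at-0 (const (c 0) ⊛ compose (tail e) ⊕ compose (tail c ⊛ e))
                                 (const (c 0) ⊛ compose (tail e) ⊕ compose (tail c) ⊛ compose e)))
                   (sym (⊛-compose-horner c e 0)))
    agree (suc n) c (suc i) (s≤s i≤n) =
      trans (compose-⊛-horner c e (suc i))
            (trans (cong (_+_ ((const (c 0) ⊛ const (e 0)) (suc i)))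
                         (⊛-cong-≈[]-suc i (⊕-cong-≈[] i {const (c 0) ⊛ compose (tail e)} (λ _ _ → refl)
                                                            (λ j j≤i → agree n (tail c) j (ℕP.≤-trans j≤i i≤n)))
                                         (suc i) ℕP.≤-refl))
                   (sym (⊛-compose-horner c e (suc i))))

double : ℕ → ℕ
double zero = zero
double (suc k) = suc (suc (double k))

double≡2* : ∀ n → double n ≡ 2 ℕ.* n
double≡2* zero = refl
double≡2* (suc n) = trans (cong (λ m → suc (suc m)) (double≡2* n)) (sym (cong suc (ℕP.+-suc n (n ℕ.+ 0))))

-- atSquare X is X(x²).
atSquare : Series → Series
atSquare X zero = X 0
atSquare X (suc zero) = 0ℤ
atSquare X (suc (suc m)) = atSquare (tail X) m

atSquare-double : ∀ X k → atSquare X (double k) ≡ X k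
atSquare-double X zero = refl
atSquare-double X (suc k) = atSquare-double (tail X) k

atSquare-cong : ∀ {X Y} → X ≈ Y → atSquare X ≈ atSquare Y
atSquare-cong p zero = p 0
atSquare-cong p (suc zero) = refl
atSquare-cong p (suc (suc m)) = atSquare-cong (tail-cong p) m

atSquare-⊕ : ∀ X Y → atSquare (X ⊕ Y) ≈ atSquare X ⊕ atSquare Y
atSquare-⊕ X Y zero = refl
atSquare-⊕ X Y (suc zero) = refl
atSquare-⊕ X Y (suc (suc m)) = atSquare-⊕ (tail X) (tail Y) m

atSquare-⊙ : ∀ k X → atSquare (k ⊙ X) ≈ k ⊙ atSquare X
atSquare-⊙ k X zero = refl
atSquare-⊙ k X (suc zero) = sym (ℤP.*-zeroʳ k)
atSquare-⊙ k X (suc (suc m)) = atSquare-⊙ k (tail X) m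

atSquare-𝟙 : ∀ m → atSquare 𝟙 (suc m) ≡ 0ℤ
atSquare-𝟙 zero = refl
atSquare-𝟙 (suc m) = atSquare-𝟘 m
  where
  atSquare-𝟘 : ∀ m → atSquare 𝟘 m ≡ 0ℤ
  atSquare-𝟘 zero = refl
  atSquare-𝟘 (suc zero) = refl
  atSquare-𝟘 (suc (suc m)) = atSquare-𝟘 m

atSquare-⊛ : ∀ X Y → atSquare (X ⊛ Y) ≈ atSquare X ⊛ atSquare Y
atSquare-⊛ X Y zero = refl
atSquare-⊛ X Y (suc zero) = sym (trans (cong₂ _+_ (ℤP.*-zeroʳ (X 0)) (ℤP.*-zeroˡ (Y 0))) (ℤP.+-identityʳ 0ℤ))
atSquare-⊛ X Y (suc (suc m)) = begin
    atSquare (X 0 ⊙ tail Y ⊕ tail X ⊛ Y) m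
  ≡⟨ atSquare-⊕ (X 0 ⊙ tail Y) (tail X ⊛ Y) m ⟩
    atSquare (X 0 ⊙ tail Y) m + atSquare (tail X ⊛ Y) m
  ≡⟨ cong₂ _+_ (atSquare-⊙ (X 0) (tail Y) m) (atSquare-⊛ (tail X) Y m) ⟩
    X 0 * atSquare (tail Y) m + (atSquare (tail X) ⊛ atSquare Y) m
  ≡⟨ cong (_+_ (X 0 * atSquare (tail Y) m)) (sym (trans (⊛-cong tail-atSquare (≈-refl {atSquare Y}) (suc m))
                                                         (shift-⊛ (atSquare (tail X)) (atSquare Y) (suc m)))) ⟩
    X 0 * atSquare (tail Y) m + (tail (atSquare X) ⊛ atSquare Y) (suc m) ∎
  where
  open ≡-Reasoning
  tail-atSquare : tail (atSquare X) ≈ shift (atSquare (tail X))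
  tail-atSquare zero = refl
  tail-atSquare (suc k) = refl

shiftBy : ℕ → Series → Series
shiftBy zero f = f
shiftBy (suc a) f = shift (shiftBy a f)

shiftBy-cong : ∀ a {f g} → f ≈ g → shiftBy a f ≈ shiftBy a g
shiftBy-cong zero p = p
shiftBy-cong (suc a) p = shift-cong (shiftBy-cong a p)

shiftBy-at : ∀ ℓ Z {n} → ℓ ≤ n → shiftBy ℓ Z n ≡ Z (n ∸ ℓ)
shiftBy-at zero Z _ = refl
shiftBy-at (suc ℓ) Z {suc n} (s≤s ℓ≤n) = shiftBy-at ℓ Z ℓ≤n

shiftBy≈𝐱^ˢ⊛ : ∀ a f → shiftBy a f ≈ 𝐱 ^ˢ a ⊛ f
shiftBy≈𝐱^ˢ⊛ zero f = ≈-sym (⊛-identityˡ f)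
shiftBy≈𝐱^ˢ⊛ (suc a) f =
  ≈-trans (shift-cong (shiftBy≈𝐱^ˢ⊛ a f))
          (≈-trans (≈-sym (shift-⊛ (𝐱 ^ˢ a) f)) (⊛-cong (shift≈𝐱⊛ (𝐱 ^ˢ a)) (≈-refl {f})))

⊛-shiftBy : ∀ b f g → f ⊛ shiftBy b g ≈ shiftBy b (f ⊛ g)
⊛-shiftBy zero f g = ≈-refl
⊛-shiftBy (suc b) f g =
  ≈-trans (⊛-comm f (shift (shiftBy b g)))
          (≈-trans (shift-⊛ (shiftBy b g) f) (shift-cong (≈-trans (⊛-comm (shiftBy b g) f) (⊛-shiftBy b f g))))

shiftBy-⊛ : ∀ a b f g → shiftBy a f ⊛ shiftBy b g ≈ shiftBy (a ℕ.+ b) (f ⊛ g)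
shiftBy-⊛ zero b f g = ⊛-shiftBy b f g
shiftBy-⊛ (suc a) b f g = ≈-trans (shift-⊛ (shiftBy a f) (shiftBy b g)) (shift-cong (shiftBy-⊛ a b f g))

-- stretch h X is x^h X(x²).
stretch : ℕ → Series → Series
stretch h X = shiftBy h (atSquare X)

stretch-cong : ∀ h {X Y} → X ≈ Y → stretch h X ≈ stretch h Y
stretch-cong h p = shiftBy-cong h (atSquare-cong p)

stretch-⊕ : ∀ h X Y → stretch h (X ⊕ Y) ≈ stretch h X ⊕ stretch h Y
stretch-⊕ zero X Y = atSquare-⊕ X Y
stretch-⊕ (suc h) X Y zero = refl
stretch-⊕ (suc h) X Y (suc m) = stretch-⊕ h X Y m

stretch-⊙ : ∀ h k X → stretch h (k ⊙ X) ≈ k ⊙ stretch h X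
stretch-⊙ zero k X = atSquare-⊙ k X
stretch-⊙ (suc h) k X zero = sym (ℤP.*-zeroʳ k)
stretch-⊙ (suc h) k X (suc m) = stretch-⊙ h k X m

stretch-⊛ : ∀ a b X Y → stretch a X ⊛ stretch b Y ≈ stretch (a ℕ.+ b) (X ⊛ Y)
stretch-⊛ a b X Y =
  ≈-trans (shiftBy-⊛ a b (atSquare X) (atSquare Y)) (shiftBy-cong (a ℕ.+ b) (≈-sym (atSquare-⊛ X Y)))

stretch-shift : ∀ h X → stretch h (shift X) ≈ stretch (2 ℕ.+ h) X
stretch-shift zero X zero = refl
stretch-shift zero X (suc zero) = refl
stretch-shift zero X (suc (suc m)) = refl
stretch-shift (suc h) X zero = refl
stretch-shift (suc h) X (suc m) = stretch-shift h X m

stretch-odd : ∀ ℓ Z n → stretch (suc (double ℓ)) Z (suc (double n)) ≡ shiftBy ℓ Z n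
stretch-odd zero Z n = atSquare-double Z n
stretch-odd (suc ℓ) Z zero = refl
stretch-odd (suc ℓ) Z (suc n) = stretch-odd ℓ Z n

alternate : Series → Series
alternate f n = sgn n * f n

alternate-cong : ∀ {f g} → f ≈ g → alternate f ≈ alternate g
alternate-cong p n = cong (sgn n *_) (p n)

alternate-⊕ : ∀ f g → alternate (f ⊕ g) ≈ alternate f ⊕ alternate g
alternate-⊕ f g n = ℤP.*-distribˡ-+ (sgn n) (f n) (g n)

alternate-⊛ : ∀ f g → alternate (f ⊛ g) ≈ alternate f ⊛ alternate g
alternate-⊛ f g zero = units (f 0) (g 0)
  where
  units : ∀ a b → 1ℤ * (a * b) ≡ 1ℤ * a * (1ℤ * b)
  units = solve-∀
alternate-⊛ f g (suc n) = begin
    - 1ℤ * sgn n * (f 0 * g (suc n) + (tail f ⊛ g) n)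
  ≡⟨ distribute (sgn n) (f 0) (g (suc n)) ((tail f ⊛ g) n) ⟩
    1ℤ * f 0 * (- 1ℤ * sgn n * g (suc n)) + - 1ℤ * (sgn n * (tail f ⊛ g) n)
  ≡⟨ cong (λ z → 1ℤ * f 0 * (- 1ℤ * sgn n * g (suc n)) + - 1ℤ * z) (alternate-⊛ (tail f) g n) ⟩
    1ℤ * f 0 * (- 1ℤ * sgn n * g (suc n)) + - 1ℤ * (alternate (tail f) ⊛ alternate g) n
  ≡⟨ cong (_+_ (1ℤ * f 0 * (- 1ℤ * sgn n * g (suc n))))
          (sym (trans (⊛-cong {g = alternate g} (λ i → ℤP.*-assoc (- 1ℤ) (sgn i) (f (suc i))) ≈-refl n)
                      (⊙-⊛ˡ (- 1ℤ) (alternate (tail f)) (alternate g) n))) ⟩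
    (alternate f ⊛ alternate g) (suc n) ∎
  where
  open ≡-Reasoning
  distribute : ∀ s a b c → - 1ℤ * s * (a * b + c) ≡ 1ℤ * a * (- 1ℤ * s * b) + - 1ℤ * (s * c)
  distribute = solve-∀

alternate-const : ∀ c → alternate (const c) ≈ const c
alternate-const c zero = ℤP.*-identityˡ _
alternate-const c (suc n) =
  trans (cong (sgn (suc n) *_) (ℤP.*-zeroʳ c)) (trans (ℤP.*-zeroʳ (sgn (suc n))) (sym (ℤP.*-zeroʳ c)))

alternate-𝐱 : alternate 𝐱 ≈ const (- 1ℤ) ⊛ 𝐱
alternate-𝐱 n = trans (coefficients n) (sym (const-⊛ (- 1ℤ) 𝐱 n))
  where
  coefficients : ∀ n → alternate 𝐱 n ≡ - 1ℤ * 𝐱 n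
  coefficients zero = refl
  coefficients (suc zero) = refl
  coefficients (suc (suc n)) = trans (ℤP.*-zeroʳ (sgn (suc (suc n)))) (sym (ℤP.*-zeroʳ (- 1ℤ)))

-- Catalan numbers and the generating function of S_n(a, b)

absorption : ∀ n k → suc k ℕ.* (suc n C suc k) ≡ suc n ℕ.* (n C k)
absorption n zero = trans (ℕP.*-identityˡ (suc n C 1)) (trans (nC1≡n (suc n)) (sym (ℕP.*-identityʳ (suc n))))
absorption zero (suc k) =
  trans (cong (suc (suc k) ℕ.*_) (k>n⇒nCk≡0 {1} {suc (suc k)} (s≤s (s≤s z≤n))))
        (trans (ℕP.*-zeroʳ (suc (suc k))) (sym (cong (1 ℕ.*_) (k>n⇒nCk≡0 {0} {suc k} (s≤s z≤n)))))
absorption (suc n) (suc k) = begin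
    suc (suc k) ℕ.* (suc (suc n) C suc (suc k))
  ≡⟨ cong (suc (suc k) ℕ.*_) (sym (nCk+nC[k+1]≡[n+1]C[k+1] (suc n) (suc k))) ⟩
    suc (suc k) ℕ.* (suc n C suc k ℕ.+ suc n C suc (suc k))
  ≡⟨ expand (suc k) (suc n C suc k) (suc n C suc (suc k)) ⟩
    suc k ℕ.* (suc n C suc k) ℕ.+ suc n C suc k ℕ.+ suc (suc k) ℕ.* (suc n C suc (suc k))
  ≡⟨ cong₂ (λ x y → x ℕ.+ suc n C suc k ℕ.+ y) (absorption n k) (absorption n (suc k)) ⟩
    suc n ℕ.* (n C k) ℕ.+ suc n C suc k ℕ.+ suc n ℕ.* (n C suc k)
  ≡⟨ gather (suc n) (n C k) (n C suc k) (suc n C suc k) ⟩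
    suc n ℕ.* (n C k ℕ.+ n C suc k) ℕ.+ suc n C suc k
  ≡⟨ cong (λ x → suc n ℕ.* x ℕ.+ suc n C suc k) (nCk+nC[k+1]≡[n+1]C[k+1] n k) ⟩
    suc n ℕ.* (suc n C suc k) ℕ.+ suc n C suc k
  ≡⟨ ℕP.+-comm (suc n ℕ.* (suc n C suc k)) _ ⟩
    suc (suc n) ℕ.* (suc n C suc k) ∎
  where
  open ≡-Reasoning
  expand : ∀ a b c → suc a ℕ.* (b ℕ.+ c) ≡ a ℕ.* b ℕ.+ b ℕ.+ suc a ℕ.* c
  expand = ℕ-Solver.solve-∀
  gather : ∀ a b c d → a ℕ.* b ℕ.+ d ℕ.+ a ℕ.* c ≡ a ℕ.* (b ℕ.+ c) ℕ.+ d
  gather = ℕ-Solver.solve-∀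

ballot : ∀ k → suc k ℕ.* (2 ℕ.* k C suc k) ≡ k ℕ.* (2 ℕ.* k C k)
ballot k = ℕP.+-cancelʳ-≡ (suc k ℕ.* (2 ℕ.* k C k)) _ _ (begin
    suc k ℕ.* (2 ℕ.* k C suc k) ℕ.+ suc k ℕ.* (2 ℕ.* k C k)
  ≡⟨ trans (ℕP.+-comm (suc k ℕ.* (2 ℕ.* k C suc k)) _)
           (sym (ℕP.*-distribˡ-+ (suc k) (2 ℕ.* k C k) (2 ℕ.* k C suc k))) ⟩
    suc k ℕ.* (2 ℕ.* k C k ℕ.+ 2 ℕ.* k C suc k)
  ≡⟨ cong (suc k ℕ.*_) (nCk+nC[k+1]≡[n+1]C[k+1] (2 ℕ.* k) k) ⟩
    suc k ℕ.* (suc (2 ℕ.* k) C suc k)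
  ≡⟨ absorption (2 ℕ.* k) k ⟩
    suc (2 ℕ.* k) ℕ.* (2 ℕ.* k C k)
  ≡⟨ split k (2 ℕ.* k C k) ⟩
    k ℕ.* (2 ℕ.* k C k) ℕ.+ suc k ℕ.* (2 ℕ.* k C k) ∎)
  where
  open ≡-Reasoning
  split : ∀ k c → suc (2 ℕ.* k) ℕ.* c ≡ k ℕ.* c ℕ.+ suc k ℕ.* c
  split = ℕ-Solver.solve-∀

-- This makes the division in Catalan exact.
central≡difference*suc : ∀ k → 2 ℕ.* k C k ≡ (2 ℕ.* k C k ∸ 2 ℕ.* k C suc k) ℕ.* suc k
central≡difference*suc k = sym (begin
    (c ∸ c′) ℕ.* suc k
  ≡⟨ ℕP.*-distribʳ-∸ (suc k) c c′ ⟩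
    c ℕ.* suc k ∸ c′ ℕ.* suc k
  ≡⟨ cong₂ _∸_ (expand c k) (trans (ℕP.*-comm c′ (suc k)) (ballot k)) ⟩
    k ℕ.* c ℕ.+ c ∸ k ℕ.* c
  ≡⟨ ℕP.m+n∸m≡n (k ℕ.* c) c ⟩
    c ∎)
  where
  open ≡-Reasoning
  c = 2 ℕ.* k C k
  c′ = 2 ℕ.* k C suc k
  expand : ∀ c k → c ℕ.* suc k ≡ k ℕ.* c ℕ.+ c
  expand = ℕ-Solver.solve-∀

central≡Catalan*suc : ∀ k → 2 ℕ.* k C k ≡ Catalan k ℕ.* suc k
central≡Catalan*suc k = trans (central≡difference*suc k) (cong (ℕ._* suc k) (sym Catalan≡difference))
  where
  Catalan≡difference : Catalan k ≡ 2 ℕ.* k C k ∸ 2 ℕ.* k C suc k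
  Catalan≡difference =
    trans (cong (λ c → c ℕ./ suc k) (central≡difference*suc k)) (m*n/n≡m (2 ℕ.* k C k ∸ 2 ℕ.* k C suc k) (suc k))

central-rec : ∀ k → suc k ℕ.* (2 ℕ.* suc k C suc k) ≡ (2 ℕ.+ 4 ℕ.* k) ℕ.* (2 ℕ.* k C k)
central-rec k = ℕP.*-cancelˡ-≡ _ _ (suc k) (begin
    suc k ℕ.* (suc k ℕ.* (2 ℕ.* suc k C suc k))
  ≡⟨ cong (λ n → suc k ℕ.* (suc k ℕ.* (n C suc k))) (2*suc k) ⟩
    suc k ℕ.* (suc k ℕ.* (suc (suc (2 ℕ.* k)) C suc k))
  ≡⟨ cong (suc k ℕ.*_) (absorption (suc (2 ℕ.* k)) k) ⟩
    suc k ℕ.* (suc (suc (2 ℕ.* k)) ℕ.* (suc (2 ℕ.* k) C k))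
  ≡⟨ cong (λ c → suc k ℕ.* (suc (suc (2 ℕ.* k)) ℕ.* c)) symmetry ⟩
    suc k ℕ.* (suc (suc (2 ℕ.* k)) ℕ.* (suc (2 ℕ.* k) C suc k))
  ≡⟨ left-comm (suc k) (suc (suc (2 ℕ.* k))) (suc (2 ℕ.* k) C suc k) ⟩
    suc (suc (2 ℕ.* k)) ℕ.* (suc k ℕ.* (suc (2 ℕ.* k) C suc k))
  ≡⟨ cong (suc (suc (2 ℕ.* k)) ℕ.*_) (absorption (2 ℕ.* k) k) ⟩
    suc (suc (2 ℕ.* k)) ℕ.* (suc (2 ℕ.* k) ℕ.* (2 ℕ.* k C k))
  ≡⟨ regroup k (2 ℕ.* k C k) ⟩
    suc k ℕ.* ((2 ℕ.+ 4 ℕ.* k) ℕ.* (2 ℕ.* k C k)) ∎)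
  where
  open ≡-Reasoning
  2*suc : ∀ k → 2 ℕ.* suc k ≡ suc (suc (2 ℕ.* k))
  2*suc = ℕ-Solver.solve-∀
  left-comm : ∀ a b c → a ℕ.* (b ℕ.* c) ≡ b ℕ.* (a ℕ.* c)
  left-comm = ℕ-Solver.solve-∀
  regroup : ∀ k c → suc (suc (2 ℕ.* k)) ℕ.* (suc (2 ℕ.* k) ℕ.* c) ≡ suc k ℕ.* ((2 ℕ.+ 4 ℕ.* k) ℕ.* c)
  regroup = ℕ-Solver.solve-∀
  symmetry : suc (2 ℕ.* k) C k ≡ suc (2 ℕ.* k) C suc k
  symmetry = trans (nCk≡nC[n∸k] (ℕP.m≤n⇒m≤1+n (ℕP.m≤m+n k (k ℕ.+ 0))))
                   (cong (suc (2 ℕ.* k) C_) (trans (cong (_∸ k) (split k)) (ℕP.m+n∸m≡n k (suc k))))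
    where
    split : ∀ k → suc (2 ℕ.* k) ≡ k ℕ.+ suc k
    split = ℕ-Solver.solve-∀

Catalan-rec : ∀ k → suc (suc k) ℕ.* Catalan (suc k) ≡ (2 ℕ.+ 4 ℕ.* k) ℕ.* Catalan k
Catalan-rec k = ℕP.*-cancelˡ-≡ _ _ (suc k) (begin
    suc k ℕ.* (suc (suc k) ℕ.* Catalan (suc k))
  ≡⟨ cong (suc k ℕ.*_) (trans (ℕP.*-comm (suc (suc k)) (Catalan (suc k))) (sym (central≡Catalan*suc (suc k)))) ⟩
    suc k ℕ.* (2 ℕ.* suc k C suc k)
  ≡⟨ central-rec k ⟩
    (2 ℕ.+ 4 ℕ.* k) ℕ.* (2 ℕ.* k C k)
  ≡⟨ cong ((2 ℕ.+ 4 ℕ.* k) ℕ.*_) (central≡Catalan*suc k) ⟩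
    (2 ℕ.+ 4 ℕ.* k) ℕ.* (Catalan k ℕ.* suc k)
  ≡⟨ rotate (2 ℕ.+ 4 ℕ.* k) (Catalan k) (suc k) ⟩
    suc k ℕ.* ((2 ℕ.+ 4 ℕ.* k) ℕ.* Catalan k) ∎)
  where
  open ≡-Reasoning
  rotate : ∀ a b c → a ℕ.* (b ℕ.* c) ≡ c ℕ.* (a ℕ.* b)
  rotate = ℕ-Solver.solve-∀

θ : Series → Series
θ f n = + n * f n

θ-cong : ∀ {f g} → f ≈ g → θ f ≈ θ g
θ-cong p n = cong (+ n *_) (p n)

θ-⊕ : ∀ f g → θ (f ⊕ g) ≈ θ f ⊕ θ g
θ-⊕ f g n = ℤP.*-distribˡ-+ (+ n) (f n) (g n)

θ-𝟙 : θ 𝟙 ≈ 𝟘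
θ-𝟙 zero = refl
θ-𝟙 (suc n) = ℤP.*-zeroʳ (+ suc n)

θ-shift : ∀ f → θ (shift f) ≈ shift f ⊕ shift (θ f)
θ-shift f zero = refl
θ-shift f (suc n) =
  trans (cong (_* f n) (ℤP.pos-+ 1 n))
        (trans (ℤP.*-distribʳ-+ (f n) 1ℤ (+ n)) (cong (_+ + n * f n) (ℤP.*-identityˡ (f n))))

tail-θ : ∀ f → tail (θ f) ≈ θ (tail f) ⊕ tail f
tail-θ f n = trans (cong (_* f (suc n)) (ℤP.pos-+ 1 n)) (trans (ℤP.*-distribʳ-+ (f (suc n)) 1ℤ (+ n))
                   (trans (cong (_+ + n * f (suc n)) (ℤP.*-identityˡ (f (suc n)))) (ℤP.+-comm (f (suc n)) _)))

θ-⊛ : ∀ f g → θ (f ⊛ g) ≈ θ f ⊛ g ⊕ f ⊛ θ g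
θ-⊛ f g zero = zeros (f 0) (g 0)
  where
  zeros : ∀ a b → + 0 * (a * b) ≡ + 0 * a * b + a * (+ 0 * b)
  zeros = solve-∀
θ-⊛ f g (suc n) = begin
    + suc n * (a * b + c)
  ≡⟨ cong (_* (a * b + c)) (ℤP.pos-+ 1 n) ⟩
    (1ℤ + + n) * (a * b + c)
  ≡⟨ expand (+ n) a b c ⟩
    + 0 * a * b + (+ n * c + c) + a * ((1ℤ + + n) * b)
  ≡⟨ cong (λ t → + 0 * a * b + (t + c) + a * ((1ℤ + + n) * b)) (θ-⊛ (tail f) g n) ⟩
    + 0 * a * b + ((θ (tail f) ⊛ g) n + (tail f ⊛ θ g) n + c) + a * ((1ℤ + + n) * b)
  ≡⟨ regroup (+ 0 * a * b) ((θ (tail f) ⊛ g) n) ((tail f ⊛ θ g) n) c (a * ((1ℤ + + n) * b)) ⟩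
    + 0 * a * b + ((θ (tail f) ⊛ g) n + c) + (a * ((1ℤ + + n) * b) + (tail f ⊛ θ g) n)
  ≡⟨ cong₂ (λ s t → + 0 * a * b + s + (a * (t * b) + (tail f ⊛ θ g) n))
           (trans (sym (⊛-distribʳ-⊕ g (θ (tail f)) (tail f) n)) (⊛-cong (≈-sym (tail-θ f)) (≈-refl {g}) n))
           (sym (ℤP.pos-+ 1 n)) ⟩
    (θ f ⊛ g) (suc n) + (f ⊛ θ g) (suc n) ∎
  where
  open ≡-Reasoning
  a = f 0
  b = g (suc n)
  c = (tail f ⊛ g) n
  expand : ∀ m a b c → (1ℤ + m) * (a * b + c) ≡ + 0 * a * b + (m * c + c) + a * ((1ℤ + m) * b)
  expand = solve-∀
  regroup : ∀ z p q c t → z + (p + q + c) + t ≡ z + (p + c) + (t + q)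
  regroup = solve-∀

catalan : Series
catalan k = + Catalan k

-- The solution Ĉ of C = 1 + x C² has the Catalan numbers as coefficients because both satisfy
-- (k + 2) c_{k+1} = (4k + 2) c_k, which for Ĉ comes from differentiating its equation.
private
  square-causal : Causal (λ X → X ⊛ X)
  square-causal n p = ⊛-cong-≈[] n p p

  Ĉ : Series
  Ĉ = FixedPoint.fix 𝟙 (λ X → X ⊛ X) square-causal

  Ĉ-eq : Ĉ ≈ 𝟙 ⊕ shift (Ĉ ⊛ Ĉ)
  Ĉ-eq = FixedPoint.fix-eq 𝟙 (λ X → X ⊛ X) square-causal

  Ĉ-quadratic : Ĉ ≈ const 1ℤ ⊕ 𝐱 ⊛ Ĉ ⊛ Ĉ
  Ĉ-quadratic =
    ≈-trans Ĉ-eq (⊕-cong (≈-sym const-1) (≈-trans (shift≈𝐱⊛ (Ĉ ⊛ Ĉ)) (≈-sym (⊛-assoc 𝐱 Ĉ Ĉ))))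

  θĈ-eq : θ Ĉ ≈ 𝐱 ⊛ Ĉ ⊛ Ĉ ⊕ 𝐱 ⊛ (θ Ĉ ⊛ Ĉ ⊕ Ĉ ⊛ θ Ĉ)
  θĈ-eq = begin
      θ Ĉ
    ≈⟨ θ-cong Ĉ-eq ⟩
      θ (𝟙 ⊕ shift (Ĉ ⊛ Ĉ))
    ≈⟨ ≈-trans (θ-⊕ 𝟙 (shift (Ĉ ⊛ Ĉ))) (⊕-cong θ-𝟙 (θ-shift (Ĉ ⊛ Ĉ))) ⟩
      𝟘 ⊕ (shift (Ĉ ⊛ Ĉ) ⊕ shift (θ (Ĉ ⊛ Ĉ)))
    ≈⟨ (λ n → ℤP.+-identityˡ _) ⟩
      shift (Ĉ ⊛ Ĉ) ⊕ shift (θ (Ĉ ⊛ Ĉ))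
    ≈⟨ ⊕-cong (≈-trans (shift≈𝐱⊛ (Ĉ ⊛ Ĉ)) (≈-sym (⊛-assoc 𝐱 Ĉ Ĉ)))
              (≈-trans (shift-cong (θ-⊛ Ĉ Ĉ)) (shift≈𝐱⊛ _)) ⟩
      𝐱 ⊛ Ĉ ⊛ Ĉ ⊕ 𝐱 ⊛ (θ Ĉ ⊛ Ĉ ⊕ Ĉ ⊛ θ Ĉ) ∎
    where open ≈-Reasoning

  -- Eliminating Ĉ² between the two equations gives θĈ (1 − 4x) = 1 − Ĉ + 2xĈ, as (1 − 2xĈ)² = 1 − 4x.
  θĈ-linear : θ Ĉ ⊛ (const 1ℤ ⊕ const (- + 4) ⊛ 𝐱) ≈ const 1ℤ ⊕ ⊝ Ĉ ⊕ const (+ 2) ⊛ 𝐱 ⊛ Ĉ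
  θĈ-linear = ≈-using-relations (identity (θ Ĉ) Ĉ 𝐱) θĈ-eq Ĉ-quadratic
    where
    open SeriesSolver
    identity : ∀ d c x → d ⊛ (const 1ℤ ⊕ const (- + 4) ⊛ x) ≈ (const 1ℤ ⊕ ⊝ c ⊕ const (+ 2) ⊛ x ⊛ c)
         ⊕ (const 1ℤ ⊕ const (- + 2) ⊛ x ⊛ c) ⊛ (d ⊕ ⊝ (x ⊛ c ⊛ c ⊕ x ⊛ (d ⊛ c ⊕ c ⊛ d)))
         ⊕ (const 1ℤ ⊕ const (+ 2) ⊛ x ⊛ c ⊕ const (+ 4) ⊛ x ⊛ d) ⊛ (c ⊕ ⊝ (const 1ℤ ⊕ x ⊛ c ⊛ c))
    identity = solve 3 (λ d c x → d :* (con 1ℤ :+ con (- + 4) :* x) := (con 1ℤ :+ :- c :+ con (+ 2) :* x :* c)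
         :+ (con 1ℤ :+ con (- + 2) :* x :* c) :* (d :+ :- (x :* c :* c :+ x :* (d :* c :+ c :* d)))
         :+ (con 1ℤ :+ con (+ 2) :* x :* c :+ con (+ 4) :* x :* d) :* (c :+ :- (con 1ℤ :+ x :* c :* c))) ≈-refl

  Ĉ-rec : ∀ k → + suc (suc k) * Ĉ (suc k) ≡ + (2 ℕ.+ 4 ℕ.* k) * Ĉ k
  Ĉ-rec k = begin
      + suc (suc k) * Ĉ (suc k)
    ≡⟨ cong (_* Ĉ (suc k)) (ℤP.pos-+ 1 (suc k)) ⟩
      (1ℤ + + suc k) * Ĉ (suc k)
    ≡⟨ split (+ suc k) (Ĉ (suc k)) (+ k * Ĉ k) ⟩
      (+ suc k * Ĉ (suc k) + - + 4 * (+ k * Ĉ k)) + (Ĉ (suc k) + + 4 * (+ k * Ĉ k))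
    ≡⟨ cong (_+ (Ĉ (suc k) + + 4 * (+ k * Ĉ k))) (trans (sym lhs) (trans (θĈ-linear (suc k)) rhs)) ⟩
      (- Ĉ (suc k) + + 2 * Ĉ k) + (Ĉ (suc k) + + 4 * (+ k * Ĉ k))
    ≡⟨ collect (Ĉ (suc k)) (Ĉ k) (+ k) ⟩
      (+ 2 + + 4 * + k) * Ĉ k
    ≡⟨ cong (λ t → (+ 2 + t) * Ĉ k) (sym (ℤP.pos-* 4 k)) ⟩
      (+ 2 + + (4 ℕ.* k)) * Ĉ k
    ≡⟨ cong (_* Ĉ k) (sym (ℤP.pos-+ 2 (4 ℕ.* k))) ⟩
      + (2 ℕ.+ 4 ℕ.* k) * Ĉ k ∎
    where
    open ≡-Reasoning
    split : ∀ s c₁ t → (1ℤ + s) * c₁ ≡ (s * c₁ + - + 4 * t) + (c₁ + + 4 * t)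
    split = solve-∀
    collect : ∀ c₁ c₀ k → (- c₁ + + 2 * c₀) + (c₁ + + 4 * (k * c₀)) ≡ (+ 2 + + 4 * k) * c₀
    collect = solve-∀
    lhs : (θ Ĉ ⊛ (const 1ℤ ⊕ const (- + 4) ⊛ 𝐱)) (suc k) ≡ + suc k * Ĉ (suc k) + - + 4 * (+ k * Ĉ k)
    lhs = ≈-trans (⊛-distribˡ-⊕ (θ Ĉ) (const 1ℤ) (const (- + 4) ⊛ 𝐱))
                  (⊕-cong (≈-trans (⊛-cong (≈-refl {θ Ĉ}) const-1) (⊛-identityʳ (θ Ĉ)))
                          (≈-trans (⊛-cong (≈-refl {θ Ĉ}) (const-⊛ (- + 4) 𝐱))
                                   (≈-trans (⊙-⊛ʳ (- + 4) (θ Ĉ) 𝐱)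
                                            (⊙-cong (- + 4) (≈-trans (⊛-comm (θ Ĉ) 𝐱)
                                                                     (≈-sym (shift≈𝐱⊛ (θ Ĉ))))))))
                  (suc k)
    rhs : (const 1ℤ ⊕ ⊝ Ĉ ⊕ const (+ 2) ⊛ 𝐱 ⊛ Ĉ) (suc k) ≡ - Ĉ (suc k) + + 2 * Ĉ k
    rhs = cong₂ _+_ (trans (cong (_+ - Ĉ (suc k)) (ℤP.*-zeroʳ 1ℤ)) (ℤP.+-identityˡ (- Ĉ (suc k))))
                    (trans (⊛-assoc (const (+ 2)) 𝐱 Ĉ (suc k))
                           (trans (const-⊛ (+ 2) (𝐱 ⊛ Ĉ) (suc k)) (cong (+ 2 *_) (sym (shift≈𝐱⊛ Ĉ (suc k))))))

  Ĉ≈catalan : Ĉ ≈ catalan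
  Ĉ≈catalan zero = refl
  Ĉ≈catalan (suc k) = ℤP.*-cancelˡ-≡ (+ suc (suc k)) (Ĉ (suc k)) (catalan (suc k)) (begin
      + suc (suc k) * Ĉ (suc k)
    ≡⟨ Ĉ-rec k ⟩
      + (2 ℕ.+ 4 ℕ.* k) * Ĉ k
    ≡⟨ cong (+ (2 ℕ.+ 4 ℕ.* k) *_) (Ĉ≈catalan k) ⟩
      + (2 ℕ.+ 4 ℕ.* k) * + Catalan k
    ≡⟨ sym (ℤP.pos-* (2 ℕ.+ 4 ℕ.* k) (Catalan k)) ⟩
      + ((2 ℕ.+ 4 ℕ.* k) ℕ.* Catalan k)
    ≡⟨ cong +_ (sym (Catalan-rec k)) ⟩
      + (suc (suc k) ℕ.* Catalan (suc k))
    ≡⟨ ℤP.pos-* (suc (suc k)) (Catalan (suc k)) ⟩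
      + suc (suc k) * catalan (suc k) ∎)
    where open ≡-Reasoning

catalan-eq : catalan ≈ 𝟙 ⊕ shift (catalan ⊛ catalan)
catalan-eq n =
  trans (sym (Ĉ≈catalan n)) (trans (Ĉ-eq n) (cong (_+_ (𝟙 n)) (shift-cong (⊛-cong Ĉ≈catalan Ĉ≈catalan) n)))

schröder : ℤ → ℤ → Series
schröder a b n = Sab n a b

-- With g = 1/(1 − ax) and the Catalan series c, the series g · c(b x g²) satisfies the quadratic equation of
-- schröder a b, and its coefficients are read off from C(n + ℓ, 2ℓ) = [x^(n−ℓ)] g^(2ℓ+1).
module SchröderGF (a b : ℤ) where

  geometric : Series
  geometric n = a ^ n

  geometric-eq : geometric ≈ const 1ℤ ⊕ const a ⊛ 𝐱 ⊛ geometric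
  geometric-eq n = sym (trans (cong (_+_ (const 1ℤ n)) (trans (⊛-assoc (const a) 𝐱 geometric n)
                                                              (trans (const-⊛ a (𝐱 ⊛ geometric) n)
                                                                     (cong (a *_) (sym (shift≈𝐱⊛ geometric n))))))
                              (coefficient n))
    where
    coefficient : ∀ n → const 1ℤ n + a * shift geometric n ≡ geometric n
    coefficient zero = cong (_+_ 1ℤ) (ℤP.*-zeroʳ a)
    coefficient (suc n) = trans (cong (_+ a * a ^ n) (ℤP.*-zeroʳ 1ℤ)) (ℤP.+-identityˡ (a * a ^ n))

  geometric-⊛ : ∀ X j → (geometric ⊛ X) (suc j) ≡ X (suc j) + a * (geometric ⊛ X) j
  geometric-⊛ X j = cong₂ _+_ (ℤP.*-identityˡ (X (suc j))) (⊙-⊛ˡ a geometric X j)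

  geometric-^ˢ : ∀ m j → (geometric ^ˢ suc m) j ≡ + ((m ℕ.+ j) C m) * a ^ j
  geometric-^ˢ zero zero = refl
  geometric-^ˢ zero (suc j) =
    trans (geometric-⊛ 𝟙 j) (trans (cong (λ t → 0ℤ + a * t) (trans (geometric-^ˢ zero j) (ℤP.*-identityˡ (a ^ j))))
                                   (trans (ℤP.+-identityˡ _) (sym (ℤP.*-identityˡ _))))
  geometric-^ˢ (suc m) zero =
    trans (ℤP.*-identityˡ _)
          (trans (geometric-^ˢ m 0) (cong (λ t → + t * 1ℤ) (trans (diagonal {m}) (sym (diagonal {suc m})))))
    where
    diagonal : ∀ {m} → (m ℕ.+ 0) C m ≡ 1
    diagonal {m} = trans (cong (_C m) (ℕP.+-identityʳ m)) (nCn≡1 m)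
  geometric-^ˢ (suc m) (suc j) = begin
      (geometric ⊛ geometric ^ˢ suc m) (suc j)
    ≡⟨ geometric-⊛ (geometric ^ˢ suc m) j ⟩
      (geometric ^ˢ suc m) (suc j) + a * (geometric ^ˢ suc (suc m)) j
    ≡⟨ cong₂ (λ s t → s + a * t) (geometric-^ˢ m (suc j)) (geometric-^ˢ (suc m) j) ⟩
      + ((m ℕ.+ suc j) C m) * a ^ suc j + a * (+ ((suc m ℕ.+ j) C suc m) * a ^ j)
    ≡⟨ collect (+ ((m ℕ.+ suc j) C m)) (+ ((suc m ℕ.+ j) C suc m)) a (a ^ j) ⟩
      (+ ((m ℕ.+ suc j) C m) + + ((suc m ℕ.+ j) C suc m)) * a ^ suc j
    ≡⟨ cong (_* a ^ suc j) (sym (ℤP.pos-+ ((m ℕ.+ suc j) C m) _)) ⟩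
      + ((m ℕ.+ suc j) C m ℕ.+ (suc m ℕ.+ j) C suc m) * a ^ suc j
    ≡⟨ cong (λ t → + ((m ℕ.+ suc j) C m ℕ.+ t C suc m) * a ^ suc j) (sym (ℕP.+-suc m j)) ⟩
      + ((m ℕ.+ suc j) C m ℕ.+ (m ℕ.+ suc j) C suc m) * a ^ suc j
    ≡⟨ cong (λ t → + t * a ^ suc j) (nCk+nC[k+1]≡[n+1]C[k+1] (m ℕ.+ suc j) m) ⟩
      + ((suc m ℕ.+ suc j) C suc m) * a ^ suc j ∎
    where
    open ≡-Reasoning
    collect : ∀ p q a e → p * (a * e) + a * (q * e) ≡ (p + q) * (a * e)
    collect = solve-∀

  z : Series
  z = b ⊙ shift (geometric ⊛ geometric)

  open Composition z (ℤP.*-zeroʳ b)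

  z^ˢ : ∀ ℓ → z ^ˢ ℓ ≈ (b ^ ℓ) ⊙ shiftBy ℓ (geometric ^ˢ double ℓ)
  z^ˢ zero n = sym (ℤP.*-identityˡ (𝟙 n))
  z^ˢ (suc ℓ) = begin
      z ⊛ z ^ˢ ℓ
    ≈⟨ ⊛-cong (≈-refl {z}) (z^ˢ ℓ) ⟩
      (b ⊙ shift (geometric ⊛ geometric)) ⊛ ((b ^ ℓ) ⊙ shiftBy ℓ (geometric ^ˢ double ℓ))
    ≈⟨ ≈-trans (⊙-⊛ˡ b _ _) (⊙-cong b (⊙-⊛ʳ (b ^ ℓ) _ _)) ⟩
      b ⊙ ((b ^ ℓ) ⊙ (shiftBy 1 (geometric ⊛ geometric) ⊛ shiftBy ℓ (geometric ^ˢ double ℓ)))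
    ≈⟨ (λ n → sym (ℤP.*-assoc b (b ^ ℓ) _)) ⟩
      (b ^ suc ℓ) ⊙ (shiftBy 1 (geometric ⊛ geometric) ⊛ shiftBy ℓ (geometric ^ˢ double ℓ))
    ≈⟨ ⊙-cong (b ^ suc ℓ) (≈-trans (shiftBy-⊛ 1 ℓ (geometric ⊛ geometric) (geometric ^ˢ double ℓ))
                                   (shiftBy-cong (suc ℓ) (⊛-assoc geometric geometric (geometric ^ˢ double ℓ)))) ⟩
      (b ^ suc ℓ) ⊙ shiftBy (suc ℓ) (geometric ^ˢ double (suc ℓ)) ∎
    where open ≈-Reasoning

  geometric⊛z^ˢ : ∀ n ℓ → ℓ ≤ n →
    (geometric ⊛ z ^ˢ ℓ) n ≡ b ^ ℓ * (+ ((double ℓ ℕ.+ (n ∸ ℓ)) C double ℓ) * a ^ (n ∸ ℓ))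
  geometric⊛z^ˢ n ℓ ℓ≤n = begin
      (geometric ⊛ z ^ˢ ℓ) n
    ≡⟨ ⊛-cong (≈-refl {geometric}) (z^ˢ ℓ) n ⟩
      (geometric ⊛ ((b ^ ℓ) ⊙ shiftBy ℓ (geometric ^ˢ double ℓ))) n
    ≡⟨ ⊙-⊛ʳ (b ^ ℓ) geometric _ n ⟩
      b ^ ℓ * (geometric ⊛ shiftBy ℓ (geometric ^ˢ double ℓ)) n
    ≡⟨ cong (b ^ ℓ *_) (trans (⊛-shiftBy ℓ geometric (geometric ^ˢ double ℓ) n) (shiftBy-at ℓ _ ℓ≤n)) ⟩
      b ^ ℓ * (geometric ^ˢ suc (double ℓ)) (n ∸ ℓ)
    ≡⟨ cong (b ^ ℓ *_) (geometric-^ˢ (double ℓ) (n ∸ ℓ)) ⟩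
      b ^ ℓ * (+ ((double ℓ ℕ.+ (n ∸ ℓ)) C double ℓ) * a ^ (n ∸ ℓ)) ∎
    where open ≡-Reasoning

  G : Series
  G = geometric ⊛ compose catalan

  G≡Sab : ∀ n → G n ≡ Sab n a b
  G≡Sab n = begin
      (geometric ⊛ compose catalan) n
    ≡⟨ ⊛-cong-at n {geometric} {geometric} (λ _ _ → refl) (compose≈[]partialSum catalan ℕP.≤-refl) ⟩
      (geometric ⊛ partialSum catalan (suc n)) n
    ≡⟨ ⊛-∑ˢ (suc n) geometric (λ ℓ → catalan ℓ ⊙ z ^ˢ ℓ) n ⟩
      ∑ (suc n) (λ ℓ → (geometric ⊛ (catalan ℓ ⊙ z ^ˢ ℓ)) n)
    ≡⟨ ∑-cong (suc n) (λ ℓ ℓ<1+n → trans (⊙-⊛ʳ (catalan ℓ) geometric (z ^ˢ ℓ) n)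
                                          (summand ℓ (ℕP.≤-pred ℓ<1+n))) ⟩
      ∑ (suc n) (λ k → + (((n ℕ.+ k) C (2 ℕ.* k)) ℕ.* Catalan k) * a ^ (n ∸ k) * b ^ k)
    ≡⟨ sym (sumTo≡∑ n (λ k → + (((n ℕ.+ k) C (2 ℕ.* k)) ℕ.* Catalan k) * a ^ (n ∸ k) * b ^ k)) ⟩
      Sab n a b ∎
    where
    open ≡-Reasoning
    top : ∀ ℓ → ℓ ≤ n → double ℓ ℕ.+ (n ∸ ℓ) ≡ n ℕ.+ ℓ
    top ℓ ℓ≤n =
      trans (cong (ℕ._+ (n ∸ ℓ)) (trans (double≡2* ℓ) (cong (ℓ ℕ.+_) (ℕP.+-identityʳ ℓ))))
            (trans (ℕP.+-assoc ℓ ℓ (n ∸ ℓ)) (trans (cong (ℓ ℕ.+_) (ℕP.m+[n∸m]≡n ℓ≤n)) (ℕP.+-comm ℓ n)))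
    summand : ∀ ℓ → ℓ ≤ n →
      catalan ℓ * (geometric ⊛ z ^ˢ ℓ) n ≡ + (((n ℕ.+ ℓ) C (2 ℕ.* ℓ)) ℕ.* Catalan ℓ) * a ^ (n ∸ ℓ) * b ^ ℓ
    summand ℓ ℓ≤n = begin
        + Catalan ℓ * (geometric ⊛ z ^ˢ ℓ) n
      ≡⟨ cong (+ Catalan ℓ *_) (geometric⊛z^ˢ n ℓ ℓ≤n) ⟩
        + Catalan ℓ * (b ^ ℓ * (+ ((double ℓ ℕ.+ (n ∸ ℓ)) C double ℓ) * a ^ (n ∸ ℓ)))
      ≡⟨ cong (λ t → + Catalan ℓ * (b ^ ℓ * (+ t * a ^ (n ∸ ℓ)))) (cong₂ _C_ (top ℓ ℓ≤n) (double≡2* ℓ)) ⟩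
        + Catalan ℓ * (b ^ ℓ * (+ ((n ℕ.+ ℓ) C (2 ℕ.* ℓ)) * a ^ (n ∸ ℓ)))
      ≡⟨ reorder (+ Catalan ℓ) (b ^ ℓ) (+ ((n ℕ.+ ℓ) C (2 ℕ.* ℓ))) (a ^ (n ∸ ℓ)) ⟩
        + ((n ℕ.+ ℓ) C (2 ℕ.* ℓ)) * + Catalan ℓ * a ^ (n ∸ ℓ) * b ^ ℓ
      ≡⟨ cong (λ t → t * a ^ (n ∸ ℓ) * b ^ ℓ) (sym (ℤP.pos-* ((n ℕ.+ ℓ) C (2 ℕ.* ℓ)) (Catalan ℓ))) ⟩
        + (((n ℕ.+ ℓ) C (2 ℕ.* ℓ)) ℕ.* Catalan ℓ) * a ^ (n ∸ ℓ) * b ^ ℓ ∎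
      where
      reorder : ∀ c p q r → c * (p * (q * r)) ≡ q * c * r * p
      reorder = solve-∀

  G-quadratic : G ≈ const 1ℤ ⊕ const a ⊛ 𝐱 ⊛ G ⊕ const b ⊛ 𝐱 ⊛ G ⊛ G
  G-quadratic =
    ≈-using-relations (identity geometric (compose catalan) 𝐱 (const a) (const b)) geometric-eq compose-catalan-eq
    where
    compose-catalan-eq :
      compose catalan ≈ const 1ℤ ⊕ const b ⊛ 𝐱 ⊛ geometric ⊛ geometric ⊛ compose catalan ⊛ compose catalan
    compose-catalan-eq = begin
        compose catalan
      ≈⟨ ≈-trans (compose-cong catalan-eq) (compose-⊕ 𝟙 (shift (catalan ⊛ catalan))) ⟩
        compose 𝟙 ⊕ compose (shift (catalan ⊛ catalan))
      ≈⟨ ⊕-cong (≈-trans compose-𝟙 (≈-sym const-1))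
                (≈-trans (compose-shift (catalan ⊛ catalan)) (⊛-cong z≈ (compose-⊛ catalan catalan))) ⟩
        const 1ℤ ⊕ const b ⊛ (𝐱 ⊛ (geometric ⊛ geometric)) ⊛ (compose catalan ⊛ compose catalan)
      ≈⟨ reassociate (const 1ℤ) (const b) 𝐱 geometric (compose catalan) ⟩
        const 1ℤ ⊕ const b ⊛ 𝐱 ⊛ geometric ⊛ geometric ⊛ compose catalan ⊛ compose catalan ∎
      where
      open ≈-Reasoning
      open SeriesSolver
      z≈ : z ≈ const b ⊛ (𝐱 ⊛ (geometric ⊛ geometric))
      z≈ = ≈-trans (⊙-cong b (shift≈𝐱⊛ (geometric ⊛ geometric))) (≈-sym (const-⊛ b _))
      reassociate : ∀ o c x g k → o ⊕ c ⊛ (x ⊛ (g ⊛ g)) ⊛ (k ⊛ k) ≈ o ⊕ c ⊛ x ⊛ g ⊛ g ⊛ k ⊛ k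
      reassociate = solve 5 (λ o c x g k →
        o :+ c :* (x :* (g :* g)) :* (k :* k) := o :+ c :* x :* g :* g :* k :* k) ≈-refl
    open SeriesSolver
    identity : ∀ g k x ca cb → g ⊛ k ≈ (const 1ℤ ⊕ ca ⊛ x ⊛ (g ⊛ k) ⊕ cb ⊛ x ⊛ (g ⊛ k) ⊛ (g ⊛ k))
        ⊕ k ⊛ (g ⊕ ⊝ (const 1ℤ ⊕ ca ⊛ x ⊛ g))
        ⊕ const 1ℤ ⊛ (k ⊕ ⊝ (const 1ℤ ⊕ cb ⊛ x ⊛ g ⊛ g ⊛ k ⊛ k))
    identity = solve 5 (λ g k x ca cb → g :* k := (con 1ℤ :+ ca :* x :* (g :* k) :+ cb :* x :* (g :* k) :* (g :* k))
        :+ k :* (g :+ :- (con 1ℤ :+ ca :* x :* g))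
        :+ con 1ℤ :* (k :+ :- (con 1ℤ :+ cb :* x :* g :* g :* k :* k))) ≈-refl

schröder-quadratic : ∀ a b →
  schröder a b ≈ const 1ℤ ⊕ const a ⊛ 𝐱 ⊛ schröder a b ⊕ const b ⊛ 𝐱 ⊛ schröder a b ⊛ schröder a b
schröder-quadratic a b =
  ≈-trans (≈-sym G≡Sab)
          (≈-trans G-quadratic (⊕-cong (⊕-cong (≈-refl {const 1ℤ}) (⊛-cong (≈-refl {const a ⊛ 𝐱}) G≡Sab))
                                       (⊛-cong (⊛-cong (≈-refl {const b ⊛ 𝐱}) G≡Sab) G≡Sab)))
  where open SchröderGF a b

-- Counting coloured paths with an automaton

listSum : {A : Set} → (A → ℤ) → List A → ℤ
listSum f [] = 0ℤ
listSum f (x ∷ xs) = f x + listSum f xs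

listSum-cong : {A : Set} {f g : A → ℤ} → (∀ x → f x ≡ g x) → ∀ xs → listSum f xs ≡ listSum g xs
listSum-cong p [] = refl
listSum-cong p (x ∷ xs) = cong₂ _+_ (p x) (listSum-cong p xs)

listSum-zero : {A : Set} → ∀ xs → listSum {A} (λ _ → 0ℤ) xs ≡ 0ℤ
listSum-zero [] = refl
listSum-zero (x ∷ xs) = trans (ℤP.+-identityˡ _) (listSum-zero xs)

listSum-const : {A : Set} (k : ℤ) → ∀ xs → listSum {A} (λ _ → k) xs ≡ + length xs * k
listSum-const k [] = sym (ℤP.*-zeroˡ k)
listSum-const k (x ∷ xs) =
  trans (cong (_+_ k) (listSum-const k xs)) (trans (one-more k (+ length xs)) (cong (_* k) (sym (ℤP.pos-+ 1 (length xs)))))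
  where
  one-more : ∀ k m → k + m * k ≡ (1ℤ + m) * k
  one-more = solve-∀

listSum-++ : {A : Set} (f : A → ℤ) → ∀ xs ys → listSum f (xs ++ ys) ≡ listSum f xs + listSum f ys
listSum-++ f [] ys = sym (ℤP.+-identityˡ _)
listSum-++ f (x ∷ xs) ys = trans (cong (_+_ (f x)) (listSum-++ f xs ys)) (sym (ℤP.+-assoc (f x) _ _))

listSum-map : {A B : Set} (f : B → ℤ) (g : A → B) → ∀ xs → listSum f (map g xs) ≡ listSum (λ x → f (g x)) xs
listSum-map f g [] = refl
listSum-map f g (x ∷ xs) = cong (_+_ (f (g x))) (listSum-map f g xs)

listSum-concatMap : {A B : Set} (f : B → ℤ) (g : A → List B) → ∀ xs →
  listSum f (concatMap g xs) ≡ listSum (λ x → listSum f (g x)) xs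
listSum-concatMap f g [] = refl
listSum-concatMap f g (x ∷ xs) =
  trans (listSum-++ f (g x) (concat (map g xs))) (cong (_+_ (listSum f (g x))) (listSum-concatMap f g xs))

listSum-+ : {A : Set} (f g : A → ℤ) → ∀ xs → listSum (λ x → f x + g x) xs ≡ listSum f xs + listSum g xs
listSum-+ f g [] = refl
listSum-+ f g (x ∷ xs) = trans (cong (_+_ (f x + g x)) (listSum-+ f g xs)) (+-interchange (f x) (g x) _ _)

listSum-*ˡ : {A : Set} (k : ℤ) (f : A → ℤ) → ∀ xs → listSum (λ x → k * f x) xs ≡ k * listSum f xs
listSum-*ˡ k f [] = sym (ℤP.*-zeroʳ k)
listSum-*ˡ k f (x ∷ xs) = trans (cong (_+_ (k * f x)) (listSum-*ˡ k f xs)) (sym (ℤP.*-distribˡ-+ k _ _))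

listSum-*ʳ : {A : Set} (k : ℤ) (f : A → ℤ) → ∀ xs → listSum (λ x → f x * k) xs ≡ listSum f xs * k
listSum-*ʳ k f xs = trans (listSum-cong (λ x → ℤP.*-comm (f x) k) xs) (trans (listSum-*ˡ k f xs) (ℤP.*-comm k _))

listSum-swap : {A B : Set} (f : A → B → ℤ) → ∀ xs ys →
  listSum (λ x → listSum (f x) ys) xs ≡ listSum (λ y → listSum (λ x → f x y) xs) ys
listSum-swap f [] ys = sym (listSum-zero ys)
listSum-swap f (x ∷ xs) ys =
  trans (cong (_+_ (listSum (f x) ys)) (listSum-swap f xs ys)) (sym (listSum-+ (f x) (λ y → listSum (λ x′ → f x′ y) xs) ys))

listSum-allFin-suc : ∀ n (f : Fin (suc n) → ℤ) →
  listSum f (allFin (suc n)) ≡ f Fin.zero + listSum (λ c → f (Fin.suc c)) (allFin n)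
listSum-allFin-suc n f = cong (_+_ (f Fin.zero)) (trans (cong (listSum f) (sym (map-tabulate (λ c → c) Fin.suc)))
                                                       (listSum-map f Fin.suc (allFin n)))

listSum-allFin-const : ∀ n (k : ℤ) → listSum (λ (c : Fin n) → k) (allFin n) ≡ + n * k
listSum-allFin-const n k =
  trans (listSum-const k (allFin n)) (cong (λ m → + m * k) (length-tabulate {n = n} (λ c → c)))

listSum-allFin-≢ : ∀ n (c′ : Fin n) (k : ℤ) →
  listSum (λ c → if ⌊ c′ ≟ᶠ c ⌋ then 0ℤ else k) (allFin n) ≡ + (n ∸ 1) * k
listSum-allFin-≢ (suc n) Fin.zero k =
  trans (listSum-allFin-suc n (λ c → if ⌊ Fin.zero ≟ᶠ c ⌋ then 0ℤ else k))
        (trans (ℤP.+-identityˡ _) (listSum-allFin-const n k))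
listSum-allFin-≢ (suc (suc n)) (Fin.suc c″) k = begin
    listSum (λ c → if ⌊ Fin.suc c″ ≟ᶠ c ⌋ then 0ℤ else k) (allFin (suc (suc n)))
  ≡⟨ listSum-allFin-suc (suc n) (λ c → if ⌊ Fin.suc c″ ≟ᶠ c ⌋ then 0ℤ else k) ⟩
    k + listSum (λ c → if ⌊ Fin.suc c″ ≟ᶠ Fin.suc c ⌋ then 0ℤ else k) (allFin (suc n))
  ≡⟨ cong (_+_ k) (listSum-cong (λ c → cong (λ b → if b then 0ℤ else k) (⌊suc≟suc⌋ c″ c)) (allFin (suc n))) ⟩
    k + listSum (λ c → if ⌊ c″ ≟ᶠ c ⌋ then 0ℤ else k) (allFin (suc n))
  ≡⟨ cong (_+_ k) (listSum-allFin-≢ (suc n) c″ k) ⟩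
    k + + n * k
  ≡⟨ trans (one-more k (+ n)) (cong (_* k) (sym (ℤP.pos-+ 1 n))) ⟩
    + suc n * k ∎
  where
  open ≡-Reasoning
  ⌊suc≟suc⌋ : ∀ {n} (a b : Fin n) → ⌊ Fin.suc a ≟ᶠ Fin.suc b ⌋ ≡ ⌊ a ≟ᶠ b ⌋
  ⌊suc≟suc⌋ a b with a ≟ᶠ b
  ... | yes _ = refl
  ... | no _ = refl
  one-more : ∀ k m → k + m * k ≡ (1ℤ + m) * k
  one-more = solve-∀

⟦_⟧ : Bool → ℤ
⟦ true ⟧ = 1ℤ
⟦ false ⟧ = 0ℤ

length-filter : {A : Set} (p : A → Bool) → ∀ xs → + length (filterᵇ p xs) ≡ listSum (λ x → ⟦ p x ⟧) xs
length-filter p [] = refl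
length-filter p (x ∷ xs) with p x
... | true = trans (ℤP.pos-+ 1 (length (filterᵇ p xs))) (cong (_+_ 1ℤ) (length-filter p xs))
... | false = trans (length-filter p xs) (sym (ℤP.+-identityˡ _))

sum-map-filter : {A : Set} (p : A → Bool) (g : A → ℕ) → ∀ xs →
  + sum (map g (filterᵇ p xs)) ≡ listSum (λ x → ⟦ p x ⟧ * + g x) xs
sum-map-filter p g [] = refl
sum-map-filter p g (x ∷ xs) with p x
... | true = trans (ℤP.pos-+ (g x) _) (cong₂ _+_ (sym (ℤP.*-identityˡ (+ g x))) (sum-map-filter p g xs))
... | false = trans (sum-map-filter p g xs)
                    (sym (trans (cong (_+ listSum (λ x → ⟦ p x ⟧ * + g x) xs) (ℤP.*-zeroˡ (+ g x))) (ℤP.+-identityˡ _)))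

U≡sum : ∀ r n ℓ → U r n ℓ ≡ sum (map (upsAtFrom (suc ℓ) 0) (𝒜 r (suc n)))
U≡sum r n ℓ with foldr-universal _ ℕ._+_ 0 refl (λ _ _ → refl) | map (upsAtFrom (suc ℓ) 0) (𝒜 r (suc n))
... | sumℕ≗sum | xs = sumℕ≗sum xs

maybe′-cong : {X : Set} {F G : X → ℤ} → (∀ x → F x ≡ G x) → ∀ mx → maybe′ F 0ℤ mx ≡ maybe′ G 0ℤ mx
maybe′-cong p nothing = refl
maybe′-cong p (just x) = p x

module Words (r : ℕ) where

  ∑ʷ : ℕ → (List (Step r) → ℤ) → ℤ
  ∑ʷ m f = listSum f (words r m)

  ∑ʷ-cong : ∀ m {f g : List (Step r) → ℤ} → (∀ w → f w ≡ g w) → ∑ʷ m f ≡ ∑ʷ m g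
  ∑ʷ-cong m p = listSum-cong p (words r m)

  ∑ʷ-zero : ∀ m → ∑ʷ m (λ _ → 0ℤ) ≡ 0ℤ
  ∑ʷ-zero m = listSum-zero (words r m)

  ∑ʷ-+ : ∀ m (f g : List (Step r) → ℤ) → ∑ʷ m (λ w → f w + g w) ≡ ∑ʷ m f + ∑ʷ m g
  ∑ʷ-+ m f g = listSum-+ f g (words r m)

  ∑ʷ-*ˡ : ∀ m k (f : List (Step r) → ℤ) → ∑ʷ m (λ w → k * f w) ≡ k * ∑ʷ m f
  ∑ʷ-*ˡ m k f = listSum-*ˡ k f (words r m)

  ∑-steps : ∀ (g : Step r → ℤ) → listSum g (allSteps r) ≡ g u + listSum (λ c → g (d c)) (allFin r)
  ∑-steps g = cong (_+_ (g u)) (listSum-map g d (allFin r))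

  ∑ʷ-suc : ∀ m f → ∑ʷ (suc m) f ≡ listSum (λ x → ∑ʷ m (λ w → f (x ∷ w))) (allSteps r)
  ∑ʷ-suc m f =
    trans (listSum-concatMap f (λ w → map (_∷ w) (allSteps r)) (words r m))
          (trans (listSum-cong (λ w → listSum-map f (_∷ w) (allSteps r)) (words r m))
                 (listSum-swap (λ w x → f (x ∷ w)) (words r m) (allSteps r)))

  ∑ʷ-++ : ∀ a b f → ∑ʷ (a ℕ.+ b) f ≡ ∑ʷ a (λ α → ∑ʷ b (λ β → f (α ++ β)))
  ∑ʷ-++ zero b f = sym (ℤP.+-identityʳ _)
  ∑ʷ-++ (suc a) b f =
    trans (∑ʷ-suc (a ℕ.+ b) f)
          (trans (listSum-cong (λ x → ∑ʷ-++ a b (λ w → f (x ∷ w))) (allSteps r))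
                 (sym (∑ʷ-suc a (λ α → ∑ʷ b (λ β → f (α ++ β))))))

  ∑ʷ-snoc : ∀ p f → ∑ʷ (suc p) f ≡ ∑ʷ p (λ α → listSum (λ x → f (α ++ x ∷ [])) (allSteps r))
  ∑ʷ-snoc p f =
    trans (cong (λ m → ∑ʷ m f) (ℕP.+-comm 1 p))
          (trans (∑ʷ-++ p 1 f)
                 (∑ʷ-cong p (λ α → trans (∑ʷ-suc 0 (λ β → f (α ++ β)))
                                         (listSum-cong (λ x → ℤP.+-identityʳ (f (α ++ x ∷ []))) (allSteps r)))))

  -- The automaton recognising 𝒜: a state is the current height together with the colour of the last step,
  -- if that was a d-step; a missing state means the path has been rejected.
  State : Set
  State = ℕ × Maybe (Fin r)

  step : State → Step r → Maybe State
  step (h , _) u = just (suc h , nothing)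
  step (zero , _) (d c) = nothing
  step (suc h , nothing) (d c) = just (h , just c)
  step (suc h , just c′) (d c) = if ⌊ c′ ≟ᶠ c ⌋ then nothing else just (h , just c)

  run : State → List (Step r) → Maybe State
  run s [] = just s
  run s (x ∷ w) = step s x >>= λ s′ → run s′ w

  run-++ : ∀ s α β → run s (α ++ β) ≡ (run s α >>= λ s′ → run s′ β)
  run-++ s [] β = refl
  run-++ s (x ∷ α) β with step s x
  ... | nothing = refl
  ... | just s′ = run-++ s′ α β

  onAxis : Maybe State → Bool
  onAxis (just (zero , _)) = true
  onAxis (just (suc _ , _)) = false
  onAxis nothing = false

  accepts : State → List (Step r) → Bool
  accepts s w = onAxis (run s w)

  noSameDDAfter : Maybe (Fin r) → List (Step r) → Bool
  noSameDDAfter nothing w = noSameDD w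
  noSameDDAfter (just c) w = noSameDD (d c ∷ w)

  accepts-correct : ∀ h st w → dyckFrom h w ∧ noSameDDAfter st w ≡ accepts (h , st) w
  accepts-correct zero nothing [] = refl
  accepts-correct zero (just c) [] = refl
  accepts-correct (suc h) nothing [] = refl
  accepts-correct (suc h) (just c) [] = refl
  accepts-correct zero nothing (u ∷ w) = accepts-correct 1 nothing w
  accepts-correct zero (just c) (u ∷ w) = accepts-correct 1 nothing w
  accepts-correct (suc h) nothing (u ∷ w) = accepts-correct (suc (suc h)) nothing w
  accepts-correct (suc h) (just c) (u ∷ w) = accepts-correct (suc (suc h)) nothing w
  accepts-correct zero st (d c ∷ w) = refl
  accepts-correct (suc h) nothing (d c ∷ w) = accepts-correct h (just c) w
  accepts-correct (suc h) (just c′) (d c ∷ w) with c′ ≟ᶠ c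
  ... | yes _ = ∧-zeroʳ (dyckFrom h w)
  ... | no _ = accepts-correct h (just c) w

  start : State
  start = (0 , nothing)

  next : (State → ℤ) → State → ℤ
  next F s = listSum (λ x → maybe′ F 0ℤ (step s x)) (allSteps r)

  next-cong : ∀ {F G} → (∀ s → F s ≡ G s) → ∀ s → next F s ≡ next G s
  next-cong p s = listSum-cong (λ x → maybe′-cong p (step s x)) (allSteps r)

  runs : (Maybe State → ℤ) → ℕ → State → ℤ
  runs g m s = ∑ʷ m (λ w → g (run s w))

  runs-suc : ∀ g → g nothing ≡ 0ℤ → ∀ m s → runs g (suc m) s ≡ next (runs g m) s
  runs-suc g g-nothing m s =
    trans (∑ʷ-suc m (λ w → g (run s w))) (listSum-cong (λ x → first-step (step s x)) (allSteps r))
    where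
    first-step : ∀ ms → ∑ʷ m (λ w → g (ms >>= λ s′ → run s′ w)) ≡ maybe′ (runs g m) 0ℤ ms
    first-step nothing = trans (∑ʷ-cong m (λ _ → g-nothing)) (∑ʷ-zero m)
    first-step (just s′) = refl

  runs-snoc : ∀ g p s →
    runs g (suc p) s ≡ ∑ʷ p (λ α → listSum (λ x → g (run s α >>= λ s′ → run s′ (x ∷ []))) (allSteps r))
  runs-snoc g p s = trans (∑ʷ-snoc p (λ w → g (run s w)))
                          (∑ʷ-cong p (λ α → listSum-cong (λ x → cong g (run-++ s α (x ∷ []))) (allSteps r)))

  paths : ℕ → State → ℤ
  paths = runs (λ ms → ⟦ onAxis ms ⟧)

  paths-suc : ∀ m s → paths (suc m) s ≡ next (paths m) s
  paths-suc = runs-suc (λ ms → ⟦ onAxis ms ⟧) refl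

  Sᶜ≡paths : ∀ n → + Sᶜ r n ≡ paths (2 ℕ.* n) start
  Sᶜ≡paths n =
    trans (length-filter (λ w → isDyck w ∧ noSameDD w) (words r (2 ℕ.* n)))
          (listSum-cong (λ w → cong ⟦_⟧ (accepts-correct 0 nothing w)) (words r (2 ℕ.* n)))

  U≡∑ʷ : ∀ n ℓ → + U r n ℓ ≡ ∑ʷ (2 ℕ.* suc n) (λ w → ⟦ accepts start w ⟧ * + upsAtFrom (suc ℓ) 0 w)
  U≡∑ʷ n ℓ =
    trans (cong +_ (U≡sum r n ℓ))
          (trans (sum-map-filter (λ w → isDyck w ∧ noSameDD w) (upsAtFrom (suc ℓ) 0) (words r (2 ℕ.* suc n)))
                 (listSum-cong (λ w → cong (λ b → ⟦ b ⟧ * + upsAtFrom (suc ℓ) 0 w) (accepts-correct 0 nothing w))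
                               (words r (2 ℕ.* suc n))))

module PathCounts (q : ℕ) where

  r : ℕ
  r = suc q

  open Words r public

  A : Series
  A = schröder 1ℤ (+ q)

  Q : Series
  Q = const (+ q)

  A-quadratic : A ≈ const 1ℤ ⊕ const 1ℤ ⊛ 𝐱 ⊛ A ⊕ Q ⊛ 𝐱 ⊛ A ⊛ A
  A-quadratic = schröder-quadratic 1ℤ (+ q)

  A-eq : A ≈ const 1ℤ ⊕ 𝐱 ⊛ tail A
  A-eq = ≈-trans (const+shift-tail A) (⊕-cong (≈-refl {const 1ℤ}) (shift≈𝐱⊛ (tail A)))

  tail-A : tail A ≈ A ⊕ Q ⊛ A ⊛ A
  tail-A = ≈-trans (≈-sym (tail-𝐱⊛ (tail A)))
                   (≈-trans (tail-cong {𝐱 ⊛ tail A} {𝐱 ⊛ (A ⊕ Q ⊛ A ⊛ A)}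
                                       (≈-using-relations (identity 𝐱 (tail A) A Q) A-eq A-quadratic))
                            (tail-𝐱⊛ (A ⊕ Q ⊛ A ⊛ A)))
    where
    open SeriesSolver
    identity : ∀ x t a c → x ⊛ t ≈ x ⊛ (a ⊕ c ⊛ a ⊛ a) ⊕ const (- 1ℤ) ⊛ (a ⊕ ⊝ (const 1ℤ ⊕ x ⊛ t))
                                 ⊕ const 1ℤ ⊛ (a ⊕ ⊝ (const 1ℤ ⊕ const 1ℤ ⊛ x ⊛ a ⊕ c ⊛ x ⊛ a ⊛ a))
    identity = solve 4 (λ x t a c → x :* t := x :* (a :+ c :* a :* a) :+ con (- 1ℤ) :* (a :+ :- (con 1ℤ :+ x :* t))
                                   :+ con 1ℤ :* (a :+ :- (con 1ℤ :+ con 1ℤ :* x :* a :+ c :* x :* a :* a))) ≈-refl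

  1+Q≈r : const 1ℤ ⊕ Q ≈ const (+ r)
  1+Q≈r n = trans (sym (ℤP.*-distribʳ-+ (𝟙 n) 1ℤ (+ q))) (cong (_* 𝟙 n) (sym (ℤP.pos-+ 1 q)))

  -- The accepted words from (h , nothing) and from (h , just c), counted by their number of up steps
  -- (see paths≡stretch).
  free blocked : ℕ → Series
  free zero = A
  free (suc h) = Q ^ˢ h ⊛ A ^ˢ h ⊛ tail A
  blocked h = Q ^ˢ h ⊛ A ^ˢ suc h

  free-suc : ∀ h → free (suc h) ≈ shift (free (suc (suc h))) ⊕ (+ r) ⊙ blocked h
  free-suc h = ≈-trans (≈-using-relations (identity (Q ^ˢ h) (A ^ˢ h) A (tail A) Q 𝐱) tail-A A-eq)
                       (⊕-cong (≈-sym (shift≈𝐱⊛ _))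
                               (≈-trans (⊛-cong 1+Q≈r (≈-refl {blocked h})) (const-⊛ (+ r) (blocked h))))
    where
    open SeriesSolver
    identity : ∀ pq pa a t c x →
      pq ⊛ pa ⊛ t ≈ (x ⊛ ((c ⊛ pq) ⊛ (a ⊛ pa) ⊛ t) ⊕ (const 1ℤ ⊕ c) ⊛ (pq ⊛ (a ⊛ pa)))
                    ⊕ (pq ⊛ pa) ⊛ (t ⊕ ⊝ (a ⊕ c ⊛ a ⊛ a)) ⊕ (pq ⊛ pa ⊛ c ⊛ a) ⊛ (a ⊕ ⊝ (const 1ℤ ⊕ x ⊛ t))
    identity = solve 6 (λ pq pa a t c x →
      pq :* pa :* t := (x :* ((c :* pq) :* (a :* pa) :* t) :+ (con 1ℤ :+ c) :* (pq :* (a :* pa)))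
                       :+ (pq :* pa) :* (t :+ :- (a :+ c :* a :* a)) :+ (pq :* pa :* c :* a) :* (a :+ :- (con 1ℤ :+ x :* t)))
      ≈-refl

  blocked-suc : ∀ h → blocked (suc h) ≈ shift (free (suc (suc h))) ⊕ (+ q) ⊙ blocked h
  blocked-suc h = ≈-trans (≈-using-relations (identity (Q ^ˢ h) (A ^ˢ h) A (tail A) Q 𝐱) tail-A A-eq)
                          (⊕-cong (≈-sym (shift≈𝐱⊛ _)) (const-⊛ (+ q) (blocked h)))
    where
    open SeriesSolver
    identity : ∀ pq pa a t c x →
      c ⊛ pq ⊛ (a ⊛ (a ⊛ pa)) ≈ (x ⊛ ((c ⊛ pq) ⊛ (a ⊛ pa) ⊛ t) ⊕ c ⊛ (pq ⊛ (a ⊛ pa)))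
                                ⊕ const 0ℤ ⊛ (t ⊕ ⊝ (a ⊕ c ⊛ a ⊛ a)) ⊕ (c ⊛ pq ⊛ pa ⊛ a) ⊛ (a ⊕ ⊝ (const 1ℤ ⊕ x ⊛ t))
    identity = solve 6 (λ pq pa a t c x →
      c :* pq :* (a :* (a :* pa)) := (x :* ((c :* pq) :* (a :* pa) :* t) :+ c :* (pq :* (a :* pa)))
                                     :+ con 0ℤ :* (t :+ :- (a :+ c :* a :* a)) :+ (c :* pq :* pa :* a) :* (a :+ :- (con 1ℤ :+ x :* t)))
      ≈-refl

  pathsGF : ℕ → Maybe (Fin r) → Series
  pathsGF h nothing = free h
  pathsGF h (just c) = blocked h

  free-1 : free 1 ≈ tail A
  free-1 = ≈-trans (⊛-cong (⊛-identityˡ 𝟙) (≈-refl {tail A})) (⊛-identityˡ (tail A))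

  pathsGF-zero : ∀ st → pathsGF 0 st ≈ 𝟙 ⊕ shift (free 1)
  pathsGF-zero st =
    ≈-trans (pathsGF-0≈A st)
            (≈-trans A-eq (⊕-cong const-1 (≈-trans (≈-sym (shift≈𝐱⊛ (tail A))) (shift-cong (≈-sym free-1)))))
    where
    pathsGF-0≈A : ∀ st → pathsGF 0 st ≈ A
    pathsGF-0≈A nothing = ≈-refl
    pathsGF-0≈A (just c) = ≈-trans (⊛-identityˡ (A ⊛ 𝟙)) (⊛-identityʳ A)

  paths≡stretch : ∀ m h st → paths m (h , st) ≡ stretch h (pathsGF h st) m
  paths≡stretch zero zero nothing = refl
  paths≡stretch zero zero (just c) = refl
  paths≡stretch zero (suc h) st = refl
  paths≡stretch (suc m) zero st = begin
      paths (suc m) (0 , st)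
    ≡⟨ trans (paths-suc m (0 , st)) (∑-steps (λ x → maybe′ (paths m) 0ℤ (step (0 , st) x))) ⟩
      paths m (1 , nothing) + listSum (λ c → 0ℤ) (allFin r)
    ≡⟨ trans (cong₂ _+_ (paths≡stretch m 1 nothing) (listSum-zero (allFin r))) (ℤP.+-identityʳ _) ⟩
      stretch 1 (free 1) m
    ≡⟨ sym (trans (stretch-⊕ 0 𝟙 (shift (free 1)) (suc m))
                  (trans (cong₂ _+_ (atSquare-𝟙 m) (stretch-shift 0 (free 1) (suc m))) (ℤP.+-identityˡ _))) ⟩
      stretch 0 (𝟙 ⊕ shift (free 1)) (suc m)
    ≡⟨ sym (stretch-cong 0 (pathsGF-zero st) (suc m)) ⟩
      stretch 0 (pathsGF 0 st) (suc m) ∎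
    where open ≡-Reasoning
  paths≡stretch (suc m) (suc h) nothing = begin
      paths (suc m) (suc h , nothing)
    ≡⟨ trans (paths-suc m (suc h , nothing)) (∑-steps (λ x → maybe′ (paths m) 0ℤ (step (suc h , nothing) x))) ⟩
      paths m (suc (suc h) , nothing) + listSum (λ c → paths m (h , just c)) (allFin r)
    ≡⟨ cong₂ _+_ (paths≡stretch m (suc (suc h)) nothing)
                 (trans (listSum-cong (λ c → paths≡stretch m h (just c)) (allFin r)) (listSum-allFin-const r _)) ⟩
      stretch (suc (suc h)) (free (suc (suc h))) m + + r * stretch h (blocked h) m
    ≡⟨ sym (cong₂ _+_ (stretch-shift h (free (suc (suc h))) m) (stretch-⊙ h (+ r) (blocked h) m)) ⟩
      stretch h (shift (free (suc (suc h)))) m + stretch h ((+ r) ⊙ blocked h) m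
    ≡⟨ sym (trans (stretch-cong h (free-suc h) m) (stretch-⊕ h _ _ m)) ⟩
      stretch h (free (suc h)) m ∎
    where open ≡-Reasoning
  paths≡stretch (suc m) (suc h) (just c′) = begin
      paths (suc m) (suc h , just c′)
    ≡⟨ trans (paths-suc m (suc h , just c′)) (∑-steps (λ x → maybe′ (paths m) 0ℤ (step (suc h , just c′) x))) ⟩
      paths m (suc (suc h) , nothing) + listSum (λ c → maybe′ (paths m) 0ℤ (step (suc h , just c′) (d c))) (allFin r)
    ≡⟨ cong₂ _+_ (paths≡stretch m (suc (suc h)) nothing)
                 (trans (listSum-cong other-colours (allFin r)) (listSum-allFin-≢ r c′ _)) ⟩
      stretch (suc (suc h)) (free (suc (suc h))) m + + q * stretch h (blocked h) m
    ≡⟨ sym (cong₂ _+_ (stretch-shift h (free (suc (suc h))) m) (stretch-⊙ h (+ q) (blocked h) m)) ⟩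
      stretch h (shift (free (suc (suc h)))) m + stretch h ((+ q) ⊙ blocked h) m
    ≡⟨ sym (trans (stretch-cong h (blocked-suc h) m) (stretch-⊕ h _ _ m)) ⟩
      stretch h (blocked (suc h)) m ∎
    where
    open ≡-Reasoning
    other-colours : ∀ c →
      maybe′ (paths m) 0ℤ (step (suc h , just c′) (d c)) ≡ (if ⌊ c′ ≟ᶠ c ⌋ then 0ℤ else stretch h (blocked h) m)
    other-colours c with c′ ≟ᶠ c
    ... | yes _ = refl
    ... | no _ = paths≡stretch m h (just c)

  Sᶜ≡A : ∀ n → + Sᶜ r n ≡ A n
  Sᶜ≡A n = trans (Sᶜ≡paths n) (trans (paths≡stretch (2 ℕ.* n) 0 nothing)
                                     (trans (cong (atSquare A) (sym (double≡2* n))) (atSquare-double A n)))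

module Prefixes (q : ℕ) where

  open PathCounts q

  endsFreeAt endsBlockedAt endsAt : ℕ → Maybe State → ℤ
  endsFreeAt H (just (h , nothing)) = ⟦ h ≡ᵇ H ⟧
  endsFreeAt H (just (h , just _)) = 0ℤ
  endsFreeAt H nothing = 0ℤ
  endsBlockedAt H (just (h , nothing)) = 0ℤ
  endsBlockedAt H (just (h , just _)) = ⟦ h ≡ᵇ H ⟧
  endsBlockedAt H nothing = 0ℤ
  endsAt H (just (h , _)) = ⟦ h ≡ᵇ H ⟧
  endsAt H nothing = 0ℤ

  endsAt-split : ∀ H ms → endsAt H ms ≡ endsFreeAt H ms + endsBlockedAt H ms
  endsAt-split H nothing = refl
  endsAt-split H (just (h , nothing)) = sym (ℤP.+-identityʳ _)
  endsAt-split H (just (h , just c)) = sym (ℤP.+-identityˡ _)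

  private
    d-step-not-free : ∀ H s c → endsFreeAt H (run s (d c ∷ [])) ≡ 0ℤ
    d-step-not-free H (zero , _) c = refl
    d-step-not-free H (suc h , nothing) c = refl
    d-step-not-free H (suc h , just c′) c with c′ ≟ᶠ c
    ... | yes _ = refl
    ... | no _ = refl

    only-up-step-ends-free : ∀ H ms → listSum (λ x → endsFreeAt H (ms >>= λ s → run s (x ∷ []))) (allSteps r)
                           ≡ endsFreeAt H (ms >>= λ s → run s (u ∷ []))
    only-up-step-ends-free H nothing = listSum-zero (allSteps r)
    only-up-step-ends-free H (just s) =
      trans (∑-steps (λ x → endsFreeAt H (run s (x ∷ []))))
            (trans (cong (_+_ (endsFreeAt H (run s (u ∷ []))))
                         (trans (listSum-cong (d-step-not-free H s) (allFin r)) (listSum-zero (allFin r))))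
                   (ℤP.+-identityʳ _))

  freePrefixes blockedPrefixes : ℕ → Series
  freePrefixes H p = runs (endsFreeAt H) p start
  blockedPrefixes H p = runs (endsBlockedAt H) p start

  freePrefixes-0 : ∀ p → freePrefixes 0 (suc p) ≡ 0ℤ
  freePrefixes-0 p =
    trans (runs-snoc (endsFreeAt 0) p start)
          (trans (∑ʷ-cong p (λ α → trans (only-up-step-ends-free 0 (run start α)) (u-last (run start α)))) (∑ʷ-zero p))
    where
    u-last : ∀ ms → endsFreeAt 0 (ms >>= λ s → run s (u ∷ [])) ≡ 0ℤ
    u-last nothing = refl
    u-last (just s) = refl

  freePrefixes-suc : ∀ H p → freePrefixes (suc H) (suc p) ≡ freePrefixes H p + blockedPrefixes H p
  freePrefixes-suc H p =
    trans (runs-snoc (endsFreeAt (suc H)) p start)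
          (trans (∑ʷ-cong p (λ α → trans (only-up-step-ends-free (suc H) (run start α))
                                         (trans (u-last (run start α)) (endsAt-split H (run start α)))))
                 (∑ʷ-+ p (λ α → endsFreeAt H (run start α)) (λ α → endsBlockedAt H (run start α))))
    where
    u-last : ∀ ms → endsFreeAt (suc H) (ms >>= λ s → run s (u ∷ [])) ≡ endsAt H ms
    u-last nothing = refl
    u-last (just s) = refl

  blockedPrefixes-suc : ∀ H p →
    blockedPrefixes H (suc p) ≡ + r * freePrefixes (suc H) p + + q * blockedPrefixes (suc H) p
  blockedPrefixes-suc H p =
    trans (runs-snoc (endsBlockedAt H) p start)
          (trans (∑ʷ-cong p (λ α → last-step (run start α)))
                 (trans (∑ʷ-+ p (λ α → + r * free-end α) (λ α → + q * blocked-end α))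
                        (cong₂ _+_ (∑ʷ-*ˡ p (+ r) free-end) (∑ʷ-*ˡ p (+ q) blocked-end))))
    where
    free-end blocked-end : List (Step r) → ℤ
    free-end α = endsFreeAt (suc H) (run start α)
    blocked-end α = endsBlockedAt (suc H) (run start α)
    last-step : ∀ ms → listSum (λ x → endsBlockedAt H (ms >>= λ s → run s (x ∷ []))) (allSteps r)
                       ≡ + r * endsFreeAt (suc H) ms + + q * endsBlockedAt (suc H) ms
    last-step nothing = trans (listSum-zero (allSteps r)) (sym (cong₂ _+_ (ℤP.*-zeroʳ (+ r)) (ℤP.*-zeroʳ (+ q))))
    last-step (just (zero , st)) =
      trans (∑-steps (λ x → endsBlockedAt H (run (zero , st) (x ∷ []))))
            (trans (ℤP.+-identityˡ _) (trans (listSum-zero (allFin r)) (sym (at-ground st))))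
      where
      at-ground : ∀ st →
        + r * endsFreeAt (suc H) (just (zero , st)) + + q * endsBlockedAt (suc H) (just (zero , st)) ≡ 0ℤ
      at-ground nothing = cong₂ _+_ (ℤP.*-zeroʳ (+ r)) (ℤP.*-zeroʳ (+ q))
      at-ground (just c) = cong₂ _+_ (ℤP.*-zeroʳ (+ r)) (ℤP.*-zeroʳ (+ q))
    last-step (just (suc h , nothing)) =
      trans (∑-steps (λ x → endsBlockedAt H (run (suc h , nothing) (x ∷ []))))
            (trans (ℤP.+-identityˡ _)
                   (trans (listSum-allFin-const r ⟦ h ≡ᵇ H ⟧)
                          (sym (trans (cong (_+_ (+ r * ⟦ h ≡ᵇ H ⟧)) (ℤP.*-zeroʳ (+ q))) (ℤP.+-identityʳ _)))))
    last-step (just (suc h , just c′)) =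
      trans (∑-steps (λ x → endsBlockedAt H (run (suc h , just c′) (x ∷ []))))
            (trans (ℤP.+-identityˡ _)
                   (trans (listSum-cong other-colours (allFin r))
                          (trans (listSum-allFin-≢ r c′ ⟦ h ≡ᵇ H ⟧)
                                 (sym (trans (cong (_+ + q * ⟦ h ≡ᵇ H ⟧) (ℤP.*-zeroʳ (+ r))) (ℤP.+-identityˡ _))))))
      where
      other-colours : ∀ c → endsBlockedAt H (run (suc h , just c′) (d c ∷ [])) ≡ (if ⌊ c′ ≟ᶠ c ⌋ then 0ℤ else ⟦ h ≡ᵇ H ⟧)
      other-colours c with c′ ≟ᶠ c
      ... | yes _ = refl
      ... | no _ = refl

  private
    A≈𝟙⊕shift-tail : A ≈ 𝟙 ⊕ shift (tail A)
    A≈𝟙⊕shift-tail = ≈-trans (const+shift-tail A) (⊕-cong const-1 (≈-refl {shift (tail A)}))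

  A^ˢ-suc : ∀ H → A ^ˢ suc H ≈ A ^ˢ H ⊕ A ^ˢ H ⊛ shift (tail A)
  A^ˢ-suc H = ≈-trans (⊛-comm A (A ^ˢ H))
                      (≈-trans (⊛-cong (≈-refl {A ^ˢ H}) A≈𝟙⊕shift-tail)
                               (≈-trans (⊛-distribˡ-⊕ (A ^ˢ H) 𝟙 (shift (tail A))) (⊕-cong (⊛-identityʳ (A ^ˢ H)) ≈-refl)))

  A^ˢ⊛shift-tail : ∀ H →
    A ^ˢ H ⊛ shift (tail A) ≈ shift ((+ r) ⊙ A ^ˢ suc H ⊕ (+ q) ⊙ (A ^ˢ suc H ⊛ shift (tail A)))
  A^ˢ⊛shift-tail H = begin
      A ^ˢ H ⊛ shift (tail A)
    ≈⟨ ⊛-cong (≈-refl {A ^ˢ H}) (shift≈𝐱⊛ (tail A)) ⟩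
      A ^ˢ H ⊛ (𝐱 ⊛ tail A)
    ≈⟨ ≈-using-relations (identity (A ^ˢ H) A (tail A) Q 𝐱) tail-A A-eq ⟩
      𝐱 ⊛ ((const 1ℤ ⊕ Q) ⊛ (A ⊛ A ^ˢ H) ⊕ Q ⊛ (A ⊛ A ^ˢ H ⊛ (𝐱 ⊛ tail A)))
    ≈⟨ ≈-sym (shift≈𝐱⊛ _) ⟩
      shift ((const 1ℤ ⊕ Q) ⊛ (A ⊛ A ^ˢ H) ⊕ Q ⊛ (A ⊛ A ^ˢ H ⊛ (𝐱 ⊛ tail A)))
    ≈⟨ shift-cong (⊕-cong (≈-trans (⊛-cong 1+Q≈r (≈-refl {A ^ˢ suc H})) (const-⊛ (+ r) _))
                          (≈-trans (const-⊛ (+ q) _)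
                                   (⊙-cong (+ q) (⊛-cong (≈-refl {A ^ˢ suc H}) (≈-sym (shift≈𝐱⊛ (tail A))))))) ⟩
      shift ((+ r) ⊙ A ^ˢ suc H ⊕ (+ q) ⊙ (A ^ˢ suc H ⊛ shift (tail A))) ∎
    where
    open ≈-Reasoning
    open SeriesSolver
    identity : ∀ p a t c x → p ⊛ (x ⊛ t) ≈ x ⊛ ((const 1ℤ ⊕ c) ⊛ (a ⊛ p) ⊕ c ⊛ (a ⊛ p ⊛ (x ⊛ t)))
        ⊕ (x ⊛ p) ⊛ (t ⊕ ⊝ (a ⊕ c ⊛ a ⊛ a)) ⊕ (x ⊛ p ⊛ c ⊛ a) ⊛ (a ⊕ ⊝ (const 1ℤ ⊕ x ⊛ t))
    identity = solve 5 (λ p a t c x → p :* (x :* t) := x :* ((con 1ℤ :+ c) :* (a :* p) :+ c :* (a :* p :* (x :* t)))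
        :+ (x :* p) :* (t :+ :- (a :+ c :* a :* a)) :+ (x :* p :* c :* a) :* (a :+ :- (con 1ℤ :+ x :* t))) ≈-refl

  prefixes-closed : ∀ p H →
    freePrefixes H p ≡ stretch H (A ^ˢ H) p × blockedPrefixes H p ≡ stretch H (A ^ˢ H ⊛ shift (tail A)) p
  prefixes-closed zero zero = refl , refl
  prefixes-closed zero (suc H) = refl , refl
  prefixes-closed (suc p) H = free-closed H , blocked-closed
    where
    free-closed : ∀ H → freePrefixes H (suc p) ≡ stretch H (A ^ˢ H) (suc p)
    free-closed zero = trans (freePrefixes-0 p) (sym (atSquare-𝟙 p))
    free-closed (suc H) = begin
        freePrefixes (suc H) (suc p)
      ≡⟨ freePrefixes-suc H p ⟩
        freePrefixes H p + blockedPrefixes H p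
      ≡⟨ cong₂ _+_ (proj₁ (prefixes-closed p H)) (proj₂ (prefixes-closed p H)) ⟩
        stretch H (A ^ˢ H) p + stretch H (A ^ˢ H ⊛ shift (tail A)) p
      ≡⟨ sym (trans (stretch-cong H (A^ˢ-suc H) p) (stretch-⊕ H _ _ p)) ⟩
        stretch H (A ^ˢ suc H) p ∎
      where open ≡-Reasoning
    blocked-closed : blockedPrefixes H (suc p) ≡ stretch H (A ^ˢ H ⊛ shift (tail A)) (suc p)
    blocked-closed = begin
        blockedPrefixes H (suc p)
      ≡⟨ blockedPrefixes-suc H p ⟩
        + r * freePrefixes (suc H) p + + q * blockedPrefixes (suc H) p
      ≡⟨ cong₂ (λ s t → + r * s + + q * t) (proj₁ (prefixes-closed p (suc H))) (proj₂ (prefixes-closed p (suc H))) ⟩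
        + r * stretch (suc H) (A ^ˢ suc H) p + + q * stretch (suc H) (A ^ˢ suc H ⊛ shift (tail A)) p
      ≡⟨ sym (trans (stretch-⊕ (suc H) _ _ p)
                    (cong₂ _+_ (stretch-⊙ (suc H) (+ r) _ p) (stretch-⊙ (suc H) (+ q) _ p))) ⟩
        stretch (suc H) ((+ r) ⊙ A ^ˢ suc H ⊕ (+ q) ⊙ (A ^ˢ suc H ⊛ shift (tail A))) p
      ≡⟨ sym (trans (stretch-cong H (A^ˢ⊛shift-tail H) (suc p)) (stretch-shift H _ (suc p))) ⟩
        stretch H (A ^ˢ H ⊛ shift (tail A)) (suc p) ∎
      where open ≡-Reasoning

  prefixes : ℕ → State → Series
  prefixes ℓ s p = runs (endsAt ℓ) p s

  prefixes≈stretch : ∀ ℓ → prefixes ℓ start ≈ stretch ℓ (A ^ˢ suc ℓ)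
  prefixes≈stretch ℓ p = begin
      runs (endsAt ℓ) p start
    ≡⟨ trans (∑ʷ-cong p (λ α → endsAt-split ℓ (run start α))) (∑ʷ-+ p _ _) ⟩
      freePrefixes ℓ p + blockedPrefixes ℓ p
    ≡⟨ cong₂ _+_ (proj₁ (prefixes-closed p ℓ)) (proj₂ (prefixes-closed p ℓ)) ⟩
      stretch ℓ (A ^ˢ ℓ) p + stretch ℓ (A ^ˢ ℓ ⊛ shift (tail A)) p
    ≡⟨ sym (trans (stretch-cong ℓ (A^ˢ-suc ℓ) p) (stretch-⊕ ℓ _ _ p)) ⟩
      stretch ℓ (A ^ˢ suc ℓ) p ∎
    where open ≡-Reasoning

⊛-listSumˡ : {X : Set} (F : X → Series) (G : Series) → ∀ xs n →
  ((λ p → listSum (λ x → F x p) xs) ⊛ G) n ≡ listSum (λ x → (F x ⊛ G) n) xs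
⊛-listSumˡ F G [] n = ⊛-zeroˡ G n
⊛-listSumˡ F G (x ∷ xs) n =
  trans (⊛-distribʳ-⊕ G (F x) (λ p → listSum (λ x → F x p) xs) n) (cong (_+_ ((F x ⊛ G) n)) (⊛-listSumˡ F G xs n))

⊛-maybe′ˡ : {X : Set} (F : X → Series) (G : Series) → ∀ mx n →
  ((λ p → maybe′ (λ x → F x p) 0ℤ mx) ⊛ G) n ≡ maybe′ (λ x → (F x ⊛ G) n) 0ℤ mx
⊛-maybe′ˡ F G nothing n = ⊛-zeroˡ G n
⊛-maybe′ˡ F G (just x) n = refl

-- An up step ending at level ℓ + 1 cuts an accepted word into a prefix ending at height ℓ, that step,
-- and an accepted word from height ℓ + 1.
module UpSteps (q ℓ : ℕ) where

  open PathCounts q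
  open Prefixes q

  ups : State → ℕ → ℤ
  ups s m = ∑ʷ m (λ w → ⟦ accepts s w ⟧ * + upsAtFrom (suc ℓ) (proj₁ s) w)

  returns : Series
  returns m = paths m (suc ℓ , nothing)

  private
    weight : State → List (Step r) → ℤ
    weight s w = ⟦ accepts s w ⟧ * + upsAtFrom (suc ℓ) (proj₁ s) w

    ups-zero : ∀ s → ups s 0 ≡ 0ℤ
    ups-zero s = trans (ℤP.+-identityʳ _) (ℤP.*-zeroʳ ⟦ accepts s [] ⟧)

    up-step-weight : ∀ m h → ⟦ h ≡ᵇ ℓ ⟧ * returns m ≡ paths m (suc h , nothing) * ⟦ h ≡ᵇ ℓ ⟧
    up-step-weight m h with h ≡ᵇ ℓ in h≡ᵇℓ
    ... | true = trans (ℤP.*-comm 1ℤ (returns m))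
                       (cong (λ k → paths m (suc k , nothing) * 1ℤ) (sym (ℕP.≡ᵇ⇒≡ h ℓ (subst T (sym h≡ᵇℓ) tt))))
    ... | false = trans (ℤP.*-zeroˡ (returns m)) (sym (ℤP.*-zeroʳ (paths m (suc h , nothing))))

    up-first : ∀ m h st → ∑ʷ m (λ w → weight (h , st) (u ∷ w)) ≡ ⟦ h ≡ᵇ ℓ ⟧ * returns m + ups (suc h , nothing) m
    up-first m h st = begin
        ∑ʷ m (λ w → a w * + ((if h ≡ᵇ ℓ then 1 else 0) ℕ.+ n w))
      ≡⟨ ∑ʷ-cong m (λ w → trans (cong (a w *_) (trans (ℤP.pos-+ (if h ≡ᵇ ℓ then 1 else 0) (n w))
                                                     (cong (_+ + n w) (if≡⟦⟧ (h ≡ᵇ ℓ)))))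
                               (ℤP.*-distribˡ-+ (a w) ⟦ h ≡ᵇ ℓ ⟧ (+ n w))) ⟩
        ∑ʷ m (λ w → a w * ⟦ h ≡ᵇ ℓ ⟧ + a w * + n w)
      ≡⟨ ∑ʷ-+ m (λ w → a w * ⟦ h ≡ᵇ ℓ ⟧) (λ w → a w * + n w) ⟩
        ∑ʷ m (λ w → a w * ⟦ h ≡ᵇ ℓ ⟧) + ups (suc h , nothing) m
      ≡⟨ cong (_+ ups (suc h , nothing) m) (trans (listSum-*ʳ ⟦ h ≡ᵇ ℓ ⟧ a (words r m)) (sym (up-step-weight m h))) ⟩
        ⟦ h ≡ᵇ ℓ ⟧ * returns m + ups (suc h , nothing) m ∎
      where
      open ≡-Reasoning
      a : List (Step r) → ℤ
      a w = ⟦ accepts (suc h , nothing) w ⟧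
      n : List (Step r) → ℕ
      n w = upsAtFrom (suc ℓ) (suc h) w
      if≡⟦⟧ : ∀ b → + (if b then 1 else 0) ≡ ⟦ b ⟧
      if≡⟦⟧ true = refl
      if≡⟦⟧ false = refl

    down-first : ∀ m h st c →
      ∑ʷ m (λ w → weight (h , st) (d c ∷ w)) ≡ maybe′ (λ s′ → ups s′ m) 0ℤ (step (h , st) (d c))
    down-first m zero st c = trans (∑ʷ-cong m (λ w → ℤP.*-zeroˡ (+ upsAtFrom (suc ℓ) 0 w))) (∑ʷ-zero m)
    down-first m (suc h) nothing c = refl
    down-first m (suc h) (just c′) c with c′ ≟ᶠ c
    ... | yes _ = trans (∑ʷ-cong m (λ w → ℤP.*-zeroˡ (+ upsAtFrom (suc ℓ) h w))) (∑ʷ-zero m)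
    ... | no _ = refl

    ups-suc : ∀ m s → ups s (suc m) ≡ endsAt ℓ (just s) * returns m + next (λ s′ → ups s′ m) s
    ups-suc m (h , st) = begin
        ups (h , st) (suc m)
      ≡⟨ trans (∑ʷ-suc m (weight (h , st))) (∑-steps (λ x → ∑ʷ m (λ w → weight (h , st) (x ∷ w)))) ⟩
        ∑ʷ m (λ w → weight (h , st) (u ∷ w)) + listSum (λ c → ∑ʷ m (λ w → weight (h , st) (d c ∷ w))) (allFin r)
      ≡⟨ cong₂ _+_ (up-first m h st) (listSum-cong (down-first m h st) (allFin r)) ⟩
        (⟦ h ≡ᵇ ℓ ⟧ * returns m + ups (suc h , nothing) m) + listSum (λ c → next-by (d c)) (allFin r)
      ≡⟨ ℤP.+-assoc (⟦ h ≡ᵇ ℓ ⟧ * returns m) (ups (suc h , nothing) m) _ ⟩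
        ⟦ h ≡ᵇ ℓ ⟧ * returns m + (next-by u + listSum (λ c → next-by (d c)) (allFin r))
      ≡⟨ cong (_+_ (⟦ h ≡ᵇ ℓ ⟧ * returns m)) (sym (∑-steps next-by)) ⟩
        ⟦ h ≡ᵇ ℓ ⟧ * returns m + next (λ s′ → ups s′ m) (h , st) ∎
      where
      open ≡-Reasoning
      next-by : Step r → ℤ
      next-by x = maybe′ (λ s′ → ups s′ m) 0ℤ (step (h , st) x)

  ups≡prefixes⊛returns : ∀ m s → ups s (suc m) ≡ (prefixes ℓ s ⊛ returns) m
  ups≡prefixes⊛returns zero s =
    trans (ups-suc 0 s)
          (trans (cong (_+_ (endsAt ℓ (just s) * returns 0))
                       (trans (next-cong ups-zero s)
                              (trans (listSum-cong (λ x → maybe′-zero (step s x)) (allSteps r)) (listSum-zero (allSteps r)))))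
                 (trans (ℤP.+-identityʳ _) (cong (_* returns 0) (sym (ℤP.+-identityʳ (endsAt ℓ (just s)))))))
    where
    maybe′-zero : ∀ (ms : Maybe State) → maybe′ (λ _ → 0ℤ) 0ℤ ms ≡ 0ℤ
    maybe′-zero nothing = refl
    maybe′-zero (just _) = refl
  ups≡prefixes⊛returns (suc m) s = begin
      ups s (suc (suc m))
    ≡⟨ ups-suc (suc m) s ⟩
      endsAt ℓ (just s) * returns (suc m) + next (λ s′ → ups s′ (suc m)) s
    ≡⟨ cong₂ _+_ (cong (_* returns (suc m)) (sym (ℤP.+-identityʳ (endsAt ℓ (just s)))))
                 (next-cong (ups≡prefixes⊛returns m) s) ⟩
      prefixes ℓ s 0 * returns (suc m) + next (λ s′ → (prefixes ℓ s′ ⊛ returns) m) s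
    ≡⟨ cong (_+_ (prefixes ℓ s 0 * returns (suc m))) (sym tail-part) ⟩
      (prefixes ℓ s ⊛ returns) (suc m) ∎
    where
    open ≡-Reasoning
    tail-part : (tail (prefixes ℓ s) ⊛ returns) m ≡ next (λ s′ → (prefixes ℓ s′ ⊛ returns) m) s
    tail-part =
      trans (⊛-cong (λ p → runs-suc (endsAt ℓ) refl p s) (≈-refl {returns}) m)
            (trans (⊛-listSumˡ (λ x p → maybe′ (runs (endsAt ℓ) p) 0ℤ (step s x)) returns (allSteps r) m)
                   (listSum-cong (λ x → ⊛-maybe′ˡ (prefixes ℓ) returns (step s x) m) (allSteps r)))

  U≡shiftBy : ∀ n → + U r n ℓ ≡ shiftBy ℓ (A ^ˢ suc ℓ ⊛ free (suc ℓ)) n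
  U≡shiftBy n = begin
      + U r n ℓ
    ≡⟨ trans (U≡∑ʷ n ℓ) (cong (ups start) (sym (double≡2* (suc n)))) ⟩
      ups start (suc (suc (double n)))
    ≡⟨ ups≡prefixes⊛returns (suc (double n)) start ⟩
      (prefixes ℓ start ⊛ returns) (suc (double n))
    ≡⟨ ⊛-cong (prefixes≈stretch ℓ) (λ m → paths≡stretch m (suc ℓ) nothing) (suc (double n)) ⟩
      (stretch ℓ (A ^ˢ suc ℓ) ⊛ stretch (suc ℓ) (free (suc ℓ))) (suc (double n))
    ≡⟨ stretch-⊛ ℓ (suc ℓ) (A ^ˢ suc ℓ) (free (suc ℓ)) (suc (double n)) ⟩
      stretch (ℓ ℕ.+ suc ℓ) (A ^ˢ suc ℓ ⊛ free (suc ℓ)) (suc (double n))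
    ≡⟨ cong (λ k → stretch k (A ^ˢ suc ℓ ⊛ free (suc ℓ)) (suc (double n))) (ℓ+suc-ℓ ℓ) ⟩
      stretch (suc (double ℓ)) (A ^ˢ suc ℓ ⊛ free (suc ℓ)) (suc (double n))
    ≡⟨ stretch-odd ℓ _ n ⟩
      shiftBy ℓ (A ^ˢ suc ℓ ⊛ free (suc ℓ)) n ∎
    where
    open ≡-Reasoning
    ℓ+suc-ℓ : ∀ ℓ → ℓ ℕ.+ suc ℓ ≡ suc (double ℓ)
    ℓ+suc-ℓ zero = refl
    ℓ+suc-ℓ (suc ℓ) = cong suc (trans (ℕP.+-suc ℓ (suc ℓ)) (cong suc (ℓ+suc-ℓ ℓ)))

-- The alternating sum

-- The equation has the form X = 1 + x H(X) with H causal.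
quadratic-unique : ∀ c {X Y} →
  X ≈ const 1ℤ ⊕ 𝐱 ⊛ X ⊕ c ⊛ 𝐱 ⊛ X ⊛ X → Y ≈ const 1ℤ ⊕ 𝐱 ⊛ Y ⊕ c ⊛ 𝐱 ⊛ Y ⊛ Y → X ≈ Y
quadratic-unique c eX eY = FixedPoint.unique 𝟙 H H-causal (as-fixed-point eX) (as-fixed-point eY)
  where
  H : Series → Series
  H X = X ⊕ c ⊛ (X ⊛ X)
  H-causal : Causal H
  H-causal n p = ⊕-cong-≈[] n p (⊛-cong-≈[] n {c} {c} (λ _ _ → refl) (⊛-cong-≈[] n p p))
  as-fixed-point : ∀ {X} → X ≈ const 1ℤ ⊕ 𝐱 ⊛ X ⊕ c ⊛ 𝐱 ⊛ X ⊛ X → X ≈ 𝟙 ⊕ shift (H X)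
  as-fixed-point {X} e = ≈-trans e (≈-trans (factor 𝐱 X c) (⊕-cong const-1 (≈-sym (shift≈𝐱⊛ (H X)))))
    where
    open SeriesSolver
    factor : ∀ x X c → const 1ℤ ⊕ x ⊛ X ⊕ c ⊛ x ⊛ X ⊛ X ≈ const 1ℤ ⊕ x ⊛ (X ⊕ c ⊛ (X ⊛ X))
    factor = solve 3 (λ x X c → con 1ℤ :+ x :* X :+ c :* x :* X :* X := con 1ℤ :+ x :* (X :+ c :* (X :* X))) ≈-refl

module AlternatingSum (q : ℕ) where

  open PathCounts q public

  Y : Series
  Y = const (- 1ℤ) ⊛ (Q ⊛ 𝐱 ⊛ A ⊛ A)

  signed-U : ∀ n ℓ → sgn ℓ * + U r n ℓ ≡ (Y ^ˢ ℓ ⊛ (A ⊛ tail A)) n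
  signed-U n ℓ = sym (begin
      (Y ^ˢ ℓ ⊛ (A ⊛ tail A)) n
    ≡⟨ ⊛-cong Y^ˢ (≈-refl {A ⊛ tail A}) n ⟩
      (const (sgn ℓ) ⊛ (Q ^ˢ ℓ ⊛ 𝐱 ^ˢ ℓ ⊛ A ^ˢ ℓ ⊛ A ^ˢ ℓ) ⊛ (A ⊛ tail A)) n
    ≡⟨ reorder (const (sgn ℓ)) (Q ^ˢ ℓ) (𝐱 ^ˢ ℓ) (A ^ˢ ℓ) A (tail A) n ⟩
      (const (sgn ℓ) ⊛ (𝐱 ^ˢ ℓ ⊛ (A ^ˢ suc ℓ ⊛ free (suc ℓ)))) n
    ≡⟨ const-⊛ (sgn ℓ) _ n ⟩
      sgn ℓ * (𝐱 ^ˢ ℓ ⊛ (A ^ˢ suc ℓ ⊛ free (suc ℓ))) n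
    ≡⟨ cong (sgn ℓ *_) (sym (trans (UpSteps.U≡shiftBy q ℓ n) (shiftBy≈𝐱^ˢ⊛ ℓ _ n))) ⟩
      sgn ℓ * + U r n ℓ ∎)
    where
    open ≡-Reasoning
    Y^ˢ : Y ^ˢ ℓ ≈ const (sgn ℓ) ⊛ (Q ^ˢ ℓ ⊛ 𝐱 ^ˢ ℓ ⊛ A ^ˢ ℓ ⊛ A ^ˢ ℓ)
    Y^ˢ = ≈-trans (^ˢ-distrib-⊛ (const (- 1ℤ)) (Q ⊛ 𝐱 ⊛ A ⊛ A) ℓ)
                  (⊛-cong (const-^ˢ (- 1ℤ) ℓ)
                          (≈-trans (^ˢ-distrib-⊛ (Q ⊛ 𝐱 ⊛ A) A ℓ)
                                   (⊛-cong (≈-trans (^ˢ-distrib-⊛ (Q ⊛ 𝐱) A ℓ) (⊛-cong (^ˢ-distrib-⊛ Q 𝐱 ℓ) ≈-refl)) ≈-refl)))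
    open SeriesSolver
    reorder : ∀ s pq px pa a t → s ⊛ (pq ⊛ px ⊛ pa ⊛ pa) ⊛ (a ⊛ t) ≈ s ⊛ (px ⊛ (a ⊛ pa ⊛ (pq ⊛ pa ⊛ t)))
    reorder = solve 6 (λ s pq px pa a t →
      s :* (pq :* px :* pa :* pa) :* (a :* t) := s :* (px :* (a :* pa :* (pq :* pa :* t)))) ≈-refl

  Y0≡0 : Y 0 ≡ 0ℤ
  Y0≡0 = x-divides-Y 0
    where
    open SeriesSolver
    x-divides-Y : Y ≈ 𝐱 ⊛ (const (- 1ℤ) ⊛ Q ⊛ A ⊛ A)
    x-divides-Y = solve 3 (λ x c a → con (- 1ℤ) :* (c :* x :* a :* a) := x :* (con (- 1ℤ) :* c :* a :* a)) ≈-refl 𝐱 Q A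

  open Composition Y Y0≡0

  B : Series
  B = compose A

  signed-sum≡composition : ∀ n → ∑ (suc n) (λ ℓ → sgn ℓ * + U r n ℓ * A ℓ) ≡ (A ⊛ tail A ⊛ B) n
  signed-sum≡composition n = begin
      ∑ (suc n) (λ ℓ → sgn ℓ * + U r n ℓ * A ℓ)
    ≡⟨ ∑-cong (suc n) (λ ℓ _ → trans (cong (_* A ℓ) (trans (signed-U n ℓ) (⊛-comm (Y ^ˢ ℓ) W n)))
                                      (ℤP.*-comm ((W ⊛ Y ^ˢ ℓ) n) (A ℓ))) ⟩
      ∑ (suc n) (λ ℓ → A ℓ * (W ⊛ Y ^ˢ ℓ) n)
    ≡⟨ ∑-cong (suc n) (λ ℓ _ → sym (⊙-⊛ʳ (A ℓ) W (Y ^ˢ ℓ) n)) ⟩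
      ∑ (suc n) (λ ℓ → (W ⊛ (A ℓ ⊙ Y ^ˢ ℓ)) n)
    ≡⟨ sym (⊛-∑ˢ (suc n) W (λ ℓ → A ℓ ⊙ Y ^ˢ ℓ) n) ⟩
      (W ⊛ partialSum A (suc n)) n
    ≡⟨ sym (⊛-cong-at n {W} {W} (λ _ _ → refl) (compose≈[]partialSum A ℕP.≤-refl)) ⟩
      (W ⊛ B) n ∎
    where
    open ≡-Reasoning
    W : Series
    W = A ⊛ tail A

  B-quadratic : B ≈ const 1ℤ ⊕ const 1ℤ ⊛ Y ⊛ B ⊕ Q ⊛ Y ⊛ B ⊛ B
  B-quadratic = begin
      compose A
    ≈⟨ compose-cong A-quadratic ⟩
      compose (const 1ℤ ⊕ const 1ℤ ⊛ 𝐱 ⊛ A ⊕ Q ⊛ 𝐱 ⊛ A ⊛ A)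
    ≈⟨ ≈-trans (compose-⊕ (const 1ℤ ⊕ const 1ℤ ⊛ 𝐱 ⊛ A) (Q ⊛ 𝐱 ⊛ A ⊛ A))
               (⊕-cong (compose-⊕ (const 1ℤ) (const 1ℤ ⊛ 𝐱 ⊛ A)) (≈-refl {compose (Q ⊛ 𝐱 ⊛ A ⊛ A)})) ⟩
      compose (const 1ℤ) ⊕ compose (const 1ℤ ⊛ 𝐱 ⊛ A) ⊕ compose (Q ⊛ 𝐱 ⊛ A ⊛ A)
    ≈⟨ ⊕-cong (⊕-cong (compose-const 1ℤ) (monomial 1ℤ))
              (≈-trans (compose-⊛ (Q ⊛ 𝐱 ⊛ A) A) (⊛-cong (monomial (+ q)) (≈-refl {B}))) ⟩
      const 1ℤ ⊕ const 1ℤ ⊛ Y ⊛ B ⊕ Q ⊛ Y ⊛ B ⊛ B ∎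
    where
    open ≈-Reasoning
    monomial : ∀ k → compose (const k ⊛ 𝐱 ⊛ A) ≈ const k ⊛ Y ⊛ B
    monomial k = ≈-trans (compose-⊛ (const k ⊛ 𝐱) A)
                         (⊛-cong (≈-trans (compose-⊛ (const k) 𝐱) (⊛-cong (compose-const k) compose-𝐱)) (≈-refl {B}))

  c : Series
  c = const (- 1ℤ) ⊛ Q ⊛ Q

  P : Series
  P = A ⊛ B

  P-quadratic : P ≈ const 1ℤ ⊕ 𝐱 ⊛ P ⊕ c ⊛ 𝐱 ⊛ P ⊛ P
  P-quadratic n = begin
      P n
    ≡⟨ double-negation (RHS n) (P n) ⟩
      RHS n + - (RHS n + - P n)
    ≡⟨ cong (λ t → RHS n + - t) (difference-vanishes n) ⟩
      RHS n + 0ℤ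
    ≡⟨ ℤP.+-identityʳ (RHS n) ⟩
      RHS n ∎
    where
    open ≡-Reasoning
    double-negation : ∀ a b → b ≡ a + - (a + - b)
    double-negation = solve-∀
    RHS : Series
    RHS = const 1ℤ ⊕ 𝐱 ⊛ P ⊕ c ⊛ 𝐱 ⊛ P ⊛ P
    open SeriesSolver
    identity : ∀ a b x q →
      a ⊛ ((const 1ℤ ⊕ x ⊛ (a ⊛ b) ⊕ (const (- 1ℤ) ⊛ q ⊛ q) ⊛ x ⊛ (a ⊛ b) ⊛ (a ⊛ b)) ⊕ ⊝ (a ⊛ b))
        ≈ const 0ℤ ⊕ (⊝ (a ⊛ b)) ⊛ (a ⊕ ⊝ (const 1ℤ ⊕ const 1ℤ ⊛ x ⊛ a ⊕ q ⊛ x ⊛ a ⊛ a))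
           ⊕ (⊝ a) ⊛ (b ⊕ ⊝ (const 1ℤ ⊕ const 1ℤ ⊛ (const (- 1ℤ) ⊛ (q ⊛ x ⊛ a ⊛ a)) ⊛ b
                                       ⊕ q ⊛ (const (- 1ℤ) ⊛ (q ⊛ x ⊛ a ⊛ a)) ⊛ b ⊛ b))
    identity = solve 4 (λ a b x q →
      a :* ((con 1ℤ :+ x :* (a :* b) :+ (con (- 1ℤ) :* q :* q) :* x :* (a :* b) :* (a :* b)) :+ :- (a :* b))
        := con 0ℤ :+ (:- (a :* b)) :* (a :+ :- (con 1ℤ :+ con 1ℤ :* x :* a :+ q :* x :* a :* a))
           :+ (:- a) :* (b :+ :- (con 1ℤ :+ con 1ℤ :* (con (- 1ℤ) :* (q :* x :* a :* a)) :* b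
                                        :+ q :* (con (- 1ℤ) :* (q :* x :* a :* a)) :* b :* b))) ≈-refl
    difference-vanishes : RHS ⊕ ⊝ P ≈ 𝟘
    difference-vanishes = ⊛-cancel-unit A (RHS ⊕ ⊝ P) refl
      (≈-trans (≈-using-relations (identity A B 𝐱 Q) A-quadratic B-quadratic) (λ n → ℤP.*-zeroˡ (𝟙 n)))

  V : Series
  V = alternate (schröder (- 1ℤ) (+ (q ℕ.* q)))

  V-quadratic : V ≈ const 1ℤ ⊕ 𝐱 ⊛ V ⊕ c ⊛ 𝐱 ⊛ V ⊛ V
  V-quadratic = begin
      alternate S
    ≈⟨ alternate-cong (schröder-quadratic (- 1ℤ) (+ (q ℕ.* q))) ⟩
      alternate (const 1ℤ ⊕ const (- 1ℤ) ⊛ 𝐱 ⊛ S ⊕ const (+ (q ℕ.* q)) ⊛ 𝐱 ⊛ S ⊛ S)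
    ≈⟨ ≈-trans (alternate-⊕ _ _) (⊕-cong (alternate-⊕ (const 1ℤ) (const (- 1ℤ) ⊛ 𝐱 ⊛ S)) ≈-refl) ⟩
      alternate (const 1ℤ) ⊕ alternate (const (- 1ℤ) ⊛ 𝐱 ⊛ S) ⊕ alternate (const (+ (q ℕ.* q)) ⊛ 𝐱 ⊛ S ⊛ S)
    ≈⟨ ⊕-cong (⊕-cong (alternate-const 1ℤ) (monomial (- 1ℤ)))
              (≈-trans (alternate-⊛ _ S)
                       (⊛-cong (≈-trans (monomial (+ (q ℕ.* q))) (⊛-cong (⊛-cong q*q≈Q⊛Q ≈-refl) ≈-refl)) ≈-refl)) ⟩
      const 1ℤ ⊕ const (- 1ℤ) ⊛ (const (- 1ℤ) ⊛ 𝐱) ⊛ V ⊕ (Q ⊛ Q) ⊛ (const (- 1ℤ) ⊛ 𝐱) ⊛ V ⊛ V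
    ≈⟨ identity 𝐱 V Q ⟩
      const 1ℤ ⊕ 𝐱 ⊛ V ⊕ c ⊛ 𝐱 ⊛ V ⊛ V ∎
    where
    open ≈-Reasoning
    S : Series
    S = schröder (- 1ℤ) (+ (q ℕ.* q))
    monomial : ∀ k → alternate (const k ⊛ 𝐱 ⊛ S) ≈ const k ⊛ (const (- 1ℤ) ⊛ 𝐱) ⊛ V
    monomial k = ≈-trans (alternate-⊛ (const k ⊛ 𝐱) S)
                         (⊛-cong (≈-trans (alternate-⊛ (const k) 𝐱) (⊛-cong (alternate-const k) alternate-𝐱)) ≈-refl)
    q*q≈Q⊛Q : const (+ (q ℕ.* q)) ≈ Q ⊛ Q
    q*q≈Q⊛Q = ≈-trans (λ n → cong (_* 𝟙 n) (ℤP.pos-* q q)) (const-* (+ q) (+ q))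
    open SeriesSolver
    identity : ∀ x v c → const 1ℤ ⊕ const (- 1ℤ) ⊛ (const (- 1ℤ) ⊛ x) ⊛ v ⊕ (c ⊛ c) ⊛ (const (- 1ℤ) ⊛ x) ⊛ v ⊛ v
                         ≈ const 1ℤ ⊕ x ⊛ v ⊕ (const (- 1ℤ) ⊛ c ⊛ c) ⊛ x ⊛ v ⊛ v
    identity = solve 3 (λ x v c → con 1ℤ :+ con (- 1ℤ) :* (con (- 1ℤ) :* x) :* v :+ (c :* c) :* (con (- 1ℤ) :* x) :* v :* v
                                  := con 1ℤ :+ x :* v :+ (con (- 1ℤ) :* c :* c) :* x :* v :* v) ≈-refl

  signed-sum≡convolution : ∀ n → ∑ (suc n) (λ ℓ → sgn ℓ * + U r n ℓ * A ℓ) ≡ (tail A ⊛ V) n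
  signed-sum≡convolution n = begin
      ∑ (suc n) (λ ℓ → sgn ℓ * + U r n ℓ * A ℓ)
    ≡⟨ signed-sum≡composition n ⟩
      (A ⊛ tail A ⊛ B) n
    ≡⟨ ⊛-cong (⊛-comm A (tail A)) (≈-refl {B}) n ⟩
      (tail A ⊛ A ⊛ B) n
    ≡⟨ ⊛-assoc (tail A) A B n ⟩
      (tail A ⊛ P) n
    ≡⟨ ⊛-cong (≈-refl {tail A}) (quadratic-unique c P-quadratic V-quadratic) n ⟩
      (tail A ⊛ V) n ∎
    where open ≡-Reasoning

  q≡1⇒V≈𝟙 : q ≡ 1 → V ≈ 𝟙
  q≡1⇒V≈𝟙 refl = ≈-trans (quadratic-unique c V-quadratic (ones 𝐱)) const-1
    where
    open SeriesSolver
    ones : ∀ x →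
      const 1ℤ ≈ const 1ℤ ⊕ x ⊛ const 1ℤ ⊕ (const (- 1ℤ) ⊛ const 1ℤ ⊛ const 1ℤ) ⊛ x ⊛ const 1ℤ ⊛ const 1ℤ
    ones = solve 1 (λ x →
      con 1ℤ := con 1ℤ :+ x :* con 1ℤ :+ (con (- 1ℤ) :* con 1ℤ :* con 1ℤ) :* x :* con 1ℤ :* con 1ℤ) ≈-refl

alternating-sum-identity : (r : ℕ) → 2 ≤ r → (n : ℕ) →
  sumTo n (λ ℓ → sgn ℓ * (+ U r n ℓ) * (+ Sᶜ r ℓ))
  ≡ sumTo n (λ ℓ → sgn (n ∸ ℓ) * (+ Sᶜ r (suc ℓ)) * Sab (n ∸ ℓ) (- (+ 1)) (+ ((r ∸ 1) ℕ.* (r ∸ 1))))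
alternating-sum-identity (suc (suc q′)) (s≤s (s≤s z≤n)) n = begin
    sumTo n (λ ℓ → sgn ℓ * + U r n ℓ * + Sᶜ r ℓ)
  ≡⟨ trans (sumTo≡∑ n (λ ℓ → sgn ℓ * + U r n ℓ * + Sᶜ r ℓ))
           (∑-cong (suc n) (λ ℓ _ → cong (sgn ℓ * + U r n ℓ *_) (Sᶜ≡A ℓ))) ⟩
    ∑ (suc n) (λ ℓ → sgn ℓ * + U r n ℓ * A ℓ)
  ≡⟨ signed-sum≡convolution n ⟩
    (tail A ⊛ V) n
  ≡⟨ ⊛-as-∑ (tail A) V n ⟩
    ∑ (suc n) (λ ℓ → A (suc ℓ) * (sgn (n ∸ ℓ) * S (n ∸ ℓ)))
  ≡⟨ ∑-cong (suc n) (λ ℓ _ → trans (rotate (A (suc ℓ)) (sgn (n ∸ ℓ)) (S (n ∸ ℓ)))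
                                    (cong (λ a → sgn (n ∸ ℓ) * a * S (n ∸ ℓ)) (sym (Sᶜ≡A (suc ℓ))))) ⟩
    ∑ (suc n) (λ ℓ → sgn (n ∸ ℓ) * + Sᶜ r (suc ℓ) * S (n ∸ ℓ))
  ≡⟨ sym (sumTo≡∑ n (λ ℓ → sgn (n ∸ ℓ) * + Sᶜ r (suc ℓ) * S (n ∸ ℓ))) ⟩
    sumTo n (λ ℓ → sgn (n ∸ ℓ) * + Sᶜ r (suc ℓ) * S (n ∸ ℓ)) ∎
  where
  open ≡-Reasoning
  open AlternatingSum (suc q′)
  S : Series
  S = schröder (- 1ℤ) (+ (suc q′ ℕ.* suc q′))
  rotate : ∀ a s t → a * (s * t) ≡ s * a * t
  rotate = solve-∀

alternating-sum-Schröder : (n : ℕ) → sumTo n (λ ℓ → sgn ℓ * (+ U 2 n ℓ) * Schröder ℓ) ≡ Schröder (suc n)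
alternating-sum-Schröder n = begin
    sumTo n (λ ℓ → sgn ℓ * + U 2 n ℓ * Schröder ℓ)
  ≡⟨ sumTo≡∑ n (λ ℓ → sgn ℓ * + U 2 n ℓ * Schröder ℓ) ⟩
    ∑ (suc n) (λ ℓ → sgn ℓ * + U 2 n ℓ * A ℓ)
  ≡⟨ signed-sum≡convolution n ⟩
    (tail A ⊛ V) n
  ≡⟨ trans (⊛-cong (≈-refl {tail A}) (q≡1⇒V≈𝟙 refl) n) (⊛-identityʳ (tail A) n) ⟩
    Schröder (suc n) ∎
  where
  open ≡-Reasoning
  open AlternatingSum 1

corollary4p2 : ((r : ℕ) → 2 ≤ r → (n : ℕ) →
    sumTo n (λ ℓ → sgn ℓ * (+ U r n ℓ) * (+ Sᶜ r ℓ))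
    ≡ sumTo n (λ ℓ → sgn (n ∸ ℓ) * (+ Sᶜ r (suc ℓ)) * Sab (n ∸ ℓ) (- (+ 1)) (+ ((r ∸ 1) ℕ.* (r ∸ 1)))))
    × ((n : ℕ) → sumTo n (λ ℓ → sgn ℓ * (+ U 2 n ℓ) * Schröder ℓ) ≡ Schröder (suc n))
corollary4p2 = alternating-sum-identity , alternating-sum-Schröder
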